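{- Let $M$ be a matroid and suppose that $M\cong M_1\mathbin{\Box}\cdots\mathbin{\Box} M_k\cong N_1\mathbin{\Box}\cdots\mathbin{\Box} N_r$, where all the matroids $M_1,\dots,M_k$ and $N_1,\dots,N_r$ are irreducible (with respect to free product). Then $k=r$ and $M_i\cong N_i$ for $1\leq i\leq k$.
   Context: For a matroid $M$ on $S$ with rank function $\rho_M$, write $\rho(M)=\rho_M(S)$, the nullity $\nu_M(A)=|A|-\rho_M(A)$ and the rank-lack $\lambda_M(A)=\rho(M)-\rho_M(A)$ for $A\subseteq S$. For matroids $M$ on $S$ and $N$ on $T$ with $S\cap T=\emptyset$, the free product $M\mathbin{\Box} N$ is the matroid on $S\cup T$ whose independent sets are the sets $A\subseteq S\cup T$ such that $A\cap S$ is independent in $M$ and $\lambda_M(A\cap S)\geq \nu_N(A\cap T)$. Free product is associative, so iterated free products (of matroids on pairwise disjoint ground sets) are well defined. A nonempty matroid $M$ is irreducible if every factorization of $M$ as a free product of matroids contains $M$ itself as a factor (the empty matroid is by convention not irreducible). -}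

module Defs where

open import Data.Nat using (ℕ; zero; suc; _+_; _∸_; _≤_; _<_; _⊔_)
open import Data.Bool using (Bool; true; false; _∧_)
open import Data.Bool.Properties using () renaming (_≟_ to _≟ᵇ_)
open import Data.Fin using (Fin)
open import Data.Fin.Subset using (Subset; inside; outside; _∈_; _∉_; _⊆_; _∪_; ⁅_⁆; ∣_∣)
  renaming (⊥ to ∅; ⊤ to full)
open import Data.Fin.Subset.Properties using (_⊆?_)
open import Data.Vec using (Vec; []; _∷_; take; drop; tabulate; lookup)
open import Data.List using (List; []; _∷_; map; _++_; filter; foldr)
open import Data.Product using (Σ; ∃; _×_; _,_)
open import Data.Empty using (⊥)
open import Relation.Nullary using (¬_)
open import Relation.Nullary.Decidable using (_×-dec_; ⌊_⌋)
open import Relation.Binary.PropositionalEquality using (_≡_)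
open import Data.List.Relation.Unary.Any using (Any)
open import Function.Bundles using (_↔_; Inverse)

IndSys : ℕ → Set
IndSys n = Subset n → Bool

subsets : ∀ n → List (Subset n)
subsets zero    = [] ∷ []
subsets (suc n) = map (outside ∷_) (subsets n) ++ map (inside ∷_) (subsets n)

maxℕ : List ℕ → ℕ
maxℕ = foldr _⊔_ 0

rank : ∀ {n} → IndSys n → Subset n → ℕ
rank {n} ind A =
  maxℕ (map ∣_∣ (filter (λ I → (I ⊆? A) ×-dec (ind I ≟ᵇ true)) (subsets n)))

totalRank : ∀ {n} → IndSys n → ℕ
totalRank ind = rank ind full

nullity : ∀ {n} → IndSys n → Subset n → ℕ
nullity ind A = ∣ A ∣ ∸ rank ind A

rankLack : ∀ {n} → IndSys n → Subset n → ℕ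
rankLack ind A = totalRank ind ∸ rank ind A

record Matroid : Set where
  field
    size  : ℕ
    indep : IndSys size
    indep-∅   : indep ∅ ≡ true
    indep-⊆   : ∀ I J → I ⊆ J → indep J ≡ true → indep I ≡ true
    indep-aug : ∀ I J → indep I ≡ true → indep J ≡ true → ∣ I ∣ < ∣ J ∣ →
                ∃ λ x → x ∈ J × x ∉ I × indep (I ∪ ⁅ x ⁆) ≡ true

open Matroid public

-- Free product.  The ground set S ⊔ T is Fin (m + n): the first m
-- elements are S, the last n are T.  A is independent iff A ∩ S is
-- independent in M and λ_M(A ∩ S) ≥ ν_N(A ∩ T).

_≥ᵇ_ : ℕ → ℕ → Bool
a ≥ᵇ b = ⌊ b Data.Nat.≤? a ⌋

_□_ : ∀ {m n} → IndSys m → IndSys n → IndSys (m + n)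
(_□_ {m} M N) A = M (take m A) ∧ (rankLack M (take m A) ≥ᵇ nullity N (drop m A))

infixr 6 _□_

-- the empty matroid (unit for □)
emptyInd : IndSys 0
emptyInd _ = true

sizes : List Matroid → ℕ
sizes []       = 0
sizes (M ∷ Ms) = size M + sizes Ms

⨂ : (Ms : List Matroid) → IndSys (sizes Ms)
⨂ []       = emptyInd
⨂ (M ∷ Ms) = indep M □ ⨂ Ms

image : ∀ {m n} → (Fin m ↔ Fin n) → Subset m → Subset n
image σ A = tabulate (λ j → lookup A (Inverse.from σ j))

_≅ᵢ_ : ∀ {m n} → IndSys m → IndSys n → Set
_≅ᵢ_ {m} {n} I J = Σ (Fin m ↔ Fin n) λ σ → ∀ A → I A ≡ J (image σ A)

_≅_ : Matroid → Matroid → Set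
M ≅ N = indep M ≅ᵢ indep N

_≅⨂_ : Matroid → List Matroid → Set
M ≅⨂ Ms = indep M ≅ᵢ ⨂ Ms

Irreducible : Matroid → Set
Irreducible M = ¬ (size M ≡ 0) × (∀ Ms → M ≅⨂ Ms → Any (λ N → N ≅ M) Ms)

{-# OPTIONS --safe #-}
module Submission where

-- Call S a split of a matroid when the matroid is the free product of its restriction to S and
-- its contraction by S.  The first block of A □ R is a split, and an irreducible matroid has no
-- split other than ∅ and its whole ground set: sorting a proper split to the front would factor
-- it.  Let σ : A □ R ≅ C □ R′ with A and C irreducible.  The preimage under σ of the first block
-- of C □ R′ is a split of A □ R, and it meets the first block of A □ R in a split of A, so it
-- contains that block or misses it; symmetrically for σ⁻¹.  Hence either σ maps first block onto
-- first block, or A and C have one element each.  In the latter case A □ R has two elements u, v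
-- such that {u} and {v} are splits; such clones can be transposed by an automorphism, and
-- composing σ with it repairs σ.  A block-preserving isomorphism restricts to A ≅ C and, after
-- contracting a basis of A, to R ≅ R′; induction along the lists of factors does the rest.

open import Defs
open import Data.List using (List)
open import Data.List.Relation.Unary.All using (All)
open import Data.List.Relation.Binary.Pointwise using (Pointwise)

open import Data.Nat using (ℕ; zero; suc; _+_; _∸_; _≤_; _<_; _≤?_; z≤n; s≤s; s≤s⁻¹; s<s⁻¹; z<s)
open import Data.Nat.Properties hiding (_≟_)
open import Data.Bool using (true; false; _∧_; _∨_)
open import Data.Bool.Properties using (∧-identityʳ; ∨-zeroʳ; ∨-identityʳ) renaming (_≟_ to _≟ᵇ_)
open import Data.Empty using (⊥; ⊥-elim)
open import Data.Fin using (Fin; zero; suc; _↑ˡ_; _↑ʳ_; splitAt; _≟_)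
open import Data.Fin.Properties using (any?; ¬Fin0; ↑ˡ-injective; ↑ʳ-injective)
import Data.Fin.Properties as Finₚ
open import Data.Fin.Subset
  using (Subset; inside; outside; _∈_; _∉_; _⊆_; _∪_; _∩_; _─_; _-_; ⁅_⁆; ∣_∣; Nonempty)
  renaming (⊥ to ∅; ⊤ to full)
open import Data.Fin.Subset.Properties
  using (_∈?_; _⊆?_; ⊆-refl; ⊆-trans; ⊆-antisym; ⊥⊆; ⊆⊤; ∈⊤; ∉⊥; ∣⊥∣≡0; ∣⊤∣≡n; drop-∷-⊆; p⊆q⇒∣p∣≤∣q∣;
         p⊂q⇒∣p∣<∣q∣; p⊆p∪q; q⊆p∪q; x∈p∪q⁻; x∈⁅x⁆; x∈⁅y⁆⇒x≡y; x≢y⇒x∉⁅y⁆; x∈p∧x≢y⇒x∈p-y; p─q⊆p;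
         p─⊥≡p; p─⊤≡⊥; ∪-identityˡ; ∪-identityʳ; ∪-zeroʳ; ∩-identityʳ; ∩-zeroˡ; ∩-zeroʳ; Empty-unique)
open import Data.Fin.Permutation
  using (_⟨$⟩ʳ_; _⟨$⟩ˡ_; inverseˡ; inverseʳ; flip; _∘ₚ_; permutation; transpose; lift₀; ↔⇒≡)
import Data.Fin.Permutation as Perm
import Data.Fin.Permutation.Components as PC
open import Data.List using ([]; _∷_; map; filter)
open import Data.List.Membership.Propositional using () renaming (_∈_ to _∈ₗ_)
open import Data.List.Membership.Propositional.Properties
  using (∈-map⁺; ∈-map⁻; ∈-filter⁺; ∈-filter⁻) renaming (∈-++⁺ˡ to ∈ₗ-++⁺ˡ; ∈-++⁺ʳ to ∈ₗ-++⁺ʳ)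
open import Data.List.Relation.Unary.All using (_∷_)
open import Data.List.Relation.Unary.Any using (Any)
import Data.List.Relation.Unary.Any as Any
open import Data.List.Relation.Binary.Pointwise using ([]; _∷_)
open import Data.Vec using ([]; _∷_; here; there; lookup; take; drop; _++_; zipWith; replicate)
import Data.Vec as Vec
open import Data.Vec.Properties
  using ([]=⇒lookup; lookup⇒[]=; lookup∘tabulate; tabulate∘lookup; lookup-zipWith; lookup-replicate;
         lookup-++ˡ; lookup-++ʳ; zipWith-++; ++-injectiveˡ; ++-injectiveʳ; take++drop≡id; lookup-cast₁;
         cast-++ʳ; cast-sym; ++-identityʳ-eqFree)
open import Data.Vec.Relation.Binary.Pointwise.Extensional using (ext; Pointwise-≡⇒≡)
open import Data.Product using (∃; ∃₂; Σ; _×_; _,_; proj₁; proj₂)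
open import Data.Sum using (_⊎_; inj₁; inj₂; [_,_]′)
import Data.Sum as Sum
open import Function using (_∘_; id; _↔_; _⇔_; mk⇔; Equivalence)
open import Function.Bundles using (Injection)
open import Function.Definitions using (Injective)
open import Function.Properties.Inverse using (↔⇒↣)
open import Relation.Nullary using (Dec; yes; no; contradiction)
open import Relation.Nullary.Decidable using (_×-dec_)
open import Relation.Binary.PropositionalEquality

private
  variable
    n m k p q p′ q′ : ℕ

∉⇒lookup≡false : ∀ {x} (P : Subset n) → x ∉ P → lookup P x ≡ false
∉⇒lookup≡false {x = x} P x∉P with lookup P x in eq
... | true  = ⊥-elim (x∉P (lookup⇒[]= x P eq))
... | false = refl

lookup-∪ : ∀ (P Q : Subset n) i → lookup (P ∪ Q) i ≡ lookup P i ∨ lookup Q i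
lookup-∪ P Q i = lookup-zipWith _∨_ i P Q

lookup-⁅x⁆ : ∀ (x : Fin n) → lookup ⁅ x ⁆ x ≡ true
lookup-⁅x⁆ x = []=⇒lookup (x∈⁅x⁆ x)

lookup-⁅y⁆ : ∀ {x} (y : Fin n) → x ≢ y → lookup ⁅ y ⁆ x ≡ false
lookup-⁅y⁆ y x≢y = ∉⇒lookup≡false ⁅ y ⁆ (x≢y⇒x∉⁅y⁆ x≢y)

lookup-∪⁅x⁆-x : ∀ (P : Subset n) x → lookup (P ∪ ⁅ x ⁆) x ≡ true
lookup-∪⁅x⁆-x P x = trans (lookup-∪ P ⁅ x ⁆ x) (trans (cong (lookup P x ∨_) (lookup-⁅x⁆ x)) (∨-zeroʳ _))

lookup-∪⁅x⁆-≢ : ∀ (P : Subset n) {x j} → j ≢ x → lookup (P ∪ ⁅ x ⁆) j ≡ lookup P j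
lookup-∪⁅x⁆-≢ P {x} {j} j≢x =
  trans (lookup-∪ P ⁅ x ⁆ j) (trans (cong (lookup P j ∨_) (lookup-⁅y⁆ x j≢x)) (∨-identityʳ _))

∪⁅⁆-⊆ : ∀ {x} {P Q : Subset n} → P ⊆ Q → x ∈ Q → P ∪ ⁅ x ⁆ ⊆ Q
∪⁅⁆-⊆ {x = x} {P} P⊆Q x∈Q y∈ with x∈p∪q⁻ P ⁅ x ⁆ y∈
... | inj₁ y∈P  = P⊆Q y∈P
... | inj₂ y∈x  = subst (_∈ _) (sym (x∈⁅y⁆⇒x≡y x y∈x)) x∈Q

∪-monoˡ-⊆ : ∀ {P Q R : Subset n} → P ⊆ Q → P ∪ R ⊆ Q ∪ R
∪-monoˡ-⊆ {P = P} {Q} {R} P⊆Q x∈ with x∈p∪q⁻ P R x∈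
... | inj₁ x∈P = p⊆p∪q R (P⊆Q x∈P)
... | inj₂ x∈R = q⊆p∪q Q R x∈R

x∉p-x : ∀ {x} (P : Subset n) → x ∉ P - x
x∉p-x {x = zero}  (_ ∷ P) ()
x∉p-x {x = suc x} (_ ∷ P) (there x∈P-x) = x∉p-x P x∈P-x

x∉p⇒p-x≡p : ∀ {x} (P : Subset n) → x ∉ P → P - x ≡ P
x∉p⇒p-x≡p {x = zero}  (inside  ∷ P) x∉P = ⊥-elim (x∉P here)
x∉p⇒p-x≡p {x = zero}  (outside ∷ P) x∉P = cong (outside ∷_) (p─⊥≡p P)
x∉p⇒p-x≡p {x = suc x} (b ∷ P)       x∉P = cong (b ∷_) (x∉p⇒p-x≡p P (x∉P ∘ there))

p-x∪⁅x⁆≡p : ∀ {x} (P : Subset n) → x ∈ P → (P - x) ∪ ⁅ x ⁆ ≡ P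
p-x∪⁅x⁆≡p {x = zero}  (inside ∷ P) here      = cong (inside ∷_) (trans (cong (_∪ ∅) (p─⊥≡p P)) (∪-identityʳ P))
p-x∪⁅x⁆≡p {x = suc x} (b ∷ P)      (there h) = cong₂ _∷_ (∨-identityʳ b) (p-x∪⁅x⁆≡p P h)

∅─p≡∅ : ∀ (P : Subset n) → ∅ ─ P ≡ ∅
∅─p≡∅ P = ⊆-antisym (p─q⊆p ∅ P) ⊥⊆

full≡⁅x⁆ : ∀ {x : Fin n} → (∀ y → y ≡ x) → full ≡ ⁅ x ⁆
full≡⁅x⁆ {x = x} all≡x = Pointwise-≡⇒≡ (ext λ y →
  trans (lookup-replicate y true) (sym (subst (λ z → lookup ⁅ x ⁆ z ≡ true) (sym (all≡x y)) (lookup-⁅x⁆ x))))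

∣p∣≡1+∣p-x∣ : ∀ {x} (P : Subset n) → x ∈ P → ∣ P ∣ ≡ suc ∣ P - x ∣
∣p∣≡1+∣p-x∣ {x = zero}  (inside ∷ P)  here      = cong suc (sym (cong ∣_∣ (p─⊥≡p P)))
∣p∣≡1+∣p-x∣ {x = suc x} (inside  ∷ P) (there h) = cong suc (∣p∣≡1+∣p-x∣ P h)
∣p∣≡1+∣p-x∣ {x = suc x} (outside ∷ P) (there h) = ∣p∣≡1+∣p-x∣ P h

∣p∪⁅x⁆∣≡1+∣p∣ : ∀ {x} (P : Subset n) → x ∉ P → ∣ P ∪ ⁅ x ⁆ ∣ ≡ suc ∣ P ∣
∣p∪⁅x⁆∣≡1+∣p∣ {x = zero}  (inside  ∷ P) x∉P = ⊥-elim (x∉P here)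
∣p∪⁅x⁆∣≡1+∣p∣ {x = zero}  (outside ∷ P) x∉P = cong (suc ∘ ∣_∣) (∪-identityʳ P)
∣p∪⁅x⁆∣≡1+∣p∣ {x = suc x} (inside  ∷ P) x∉P = cong suc (∣p∪⁅x⁆∣≡1+∣p∣ P (x∉P ∘ there))
∣p∪⁅x⁆∣≡1+∣p∣ {x = suc x} (outside ∷ P) x∉P = ∣p∪⁅x⁆∣≡1+∣p∣ P (x∉P ∘ there)

∣p∩q∣+∣p─q∣≡∣p∣ : ∀ (P Q : Subset n) → ∣ P ∩ Q ∣ + ∣ P ─ Q ∣ ≡ ∣ P ∣
∣p∩q∣+∣p─q∣≡∣p∣ []            []            = refl
∣p∩q∣+∣p─q∣≡∣p∣ (inside  ∷ P) (inside  ∷ Q) = cong suc (∣p∩q∣+∣p─q∣≡∣p∣ P Q)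
∣p∩q∣+∣p─q∣≡∣p∣ (inside  ∷ P) (outside ∷ Q) = trans (+-suc _ _) (cong suc (∣p∩q∣+∣p─q∣≡∣p∣ P Q))
∣p∩q∣+∣p─q∣≡∣p∣ (outside ∷ P) (inside  ∷ Q) = ∣p∩q∣+∣p─q∣≡∣p∣ P Q
∣p∩q∣+∣p─q∣≡∣p∣ (outside ∷ P) (outside ∷ Q) = ∣p∩q∣+∣p─q∣≡∣p∣ P Q

⊆∧∣q∣≤∣p∣⇒p≡q : ∀ {P Q : Subset n} → P ⊆ Q → ∣ Q ∣ ≤ ∣ P ∣ → P ≡ Q
⊆∧∣q∣≤∣p∣⇒p≡q {P = []}          {[]}          _   _  = refl
⊆∧∣q∣≤∣p∣⇒p≡q {P = inside  ∷ P} {inside  ∷ Q} P⊆Q le =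
  cong (inside ∷_) (⊆∧∣q∣≤∣p∣⇒p≡q (drop-∷-⊆ P⊆Q) (s≤s⁻¹ le))
⊆∧∣q∣≤∣p∣⇒p≡q {P = outside ∷ P} {outside ∷ Q} P⊆Q le =
  cong (outside ∷_) (⊆∧∣q∣≤∣p∣⇒p≡q (drop-∷-⊆ P⊆Q) le)
⊆∧∣q∣≤∣p∣⇒p≡q {P = outside ∷ P} {inside  ∷ Q} P⊆Q le =
  ⊥-elim (<-irrefl refl (≤-trans le (p⊆q⇒∣p∣≤∣q∣ (drop-∷-⊆ P⊆Q))))
⊆∧∣q∣≤∣p∣⇒p≡q {P = inside  ∷ P} {outside ∷ Q} P⊆Q le with () ← P⊆Q here

∉⇒∣p∣<n : ∀ {y} {P : Subset n} → y ∉ P → ∣ P ∣ < n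
∉⇒∣p∣<n {n} {y} {P} y∉P = subst (∣ P ∣ <_) (∣⊤∣≡n n) (p⊂q⇒∣p∣<∣q∣ (⊆⊤ , y , ∈⊤ , y∉P))

∈⇒0<∣p∣ : ∀ {x} {P : Subset n} → x ∈ P → 0 < ∣ P ∣
∈⇒0<∣p∣ {n} {x} {P} x∈P = subst (_< ∣ P ∣) (∣⊥∣≡0 n) (p⊂q⇒∣p∣<∣q∣ (⊥⊆ , x , x∈P , ∉⊥))

private
  there-∖ : ∀ {b c} {P Q : Subset n} → ∃ (λ x → x ∈ Q × x ∉ P) → ∃ λ x → x ∈ c ∷ Q × x ∉ b ∷ P
  there-∖ (x , x∈Q , x∉P) = suc x , there x∈Q , λ { (there x∈P) → x∉P x∈P }

∣p∣<∣q∣⇒∃∈q∖p : ∀ {P Q : Subset n} → ∣ P ∣ < ∣ Q ∣ → ∃ λ x → x ∈ Q × x ∉ P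
∣p∣<∣q∣⇒∃∈q∖p {P = outside ∷ P} {inside  ∷ Q} _  = zero , here , λ ()
∣p∣<∣q∣⇒∃∈q∖p {P = inside  ∷ P} {inside  ∷ Q} lt = there-∖ (∣p∣<∣q∣⇒∃∈q∖p (s<s⁻¹ lt))
∣p∣<∣q∣⇒∃∈q∖p {P = outside ∷ P} {outside ∷ Q} lt = there-∖ (∣p∣<∣q∣⇒∃∈q∖p lt)
∣p∣<∣q∣⇒∃∈q∖p {P = inside  ∷ P} {outside ∷ Q} lt = there-∖ (∣p∣<∣q∣⇒∃∈q∖p (<-trans (n<1+n _) lt))

⊆-between : ∀ d {P Q : Subset n} → P ⊆ Q → ∣ P ∣ + d ≤ ∣ Q ∣ →
            ∃ λ R → P ⊆ R × R ⊆ Q × ∣ R ∣ ≡ ∣ P ∣ + d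
⊆-between zero    {P} P⊆Q _  = P , id , P⊆Q , sym (+-identityʳ _)
⊆-between (suc d) {P} {Q} P⊆Q le with ∣p∣<∣q∣⇒∃∈q∖p (<-≤-trans (m<m+n ∣ P ∣ z<s) le)
... | x , x∈Q , x∉P = enlarge (⊆-between d (∪⁅⁆-⊆ P⊆Q x∈Q) (≤-trans (≤-reflexive ∣P+x∣+d) le))
  where
  ∣P+x∣+d : ∣ P ∪ ⁅ x ⁆ ∣ + d ≡ ∣ P ∣ + suc d
  ∣P+x∣+d = trans (cong (_+ d) (∣p∪⁅x⁆∣≡1+∣p∣ P x∉P)) (sym (+-suc ∣ P ∣ d))
  enlarge : (∃ λ R → P ∪ ⁅ x ⁆ ⊆ R × R ⊆ Q × ∣ R ∣ ≡ ∣ P ∪ ⁅ x ⁆ ∣ + d) →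
            ∃ λ R → P ⊆ R × R ⊆ Q × ∣ R ∣ ≡ ∣ P ∣ + suc d
  enlarge (R , P+x⊆R , R⊆Q , ∣R∣) = R , P+x⊆R ∘ p⊆p∪q ⁅ x ⁆ , R⊆Q , trans ∣R∣ ∣P+x∣+d

injective⇒∣p∣≤∣q∣ : ∀ (f : Fin n → Fin m) → Injective _≡_ _≡_ f → (P : Subset n) (Q : Subset m) →
                    (∀ {x} → x ∈ P → f x ∈ Q) → ∣ P ∣ ≤ ∣ Q ∣
injective⇒∣p∣≤∣q∣ f f-inj []            Q _     = z≤n
injective⇒∣p∣≤∣q∣ f f-inj (outside ∷ P) Q f[P]⊆Q =
  injective⇒∣p∣≤∣q∣ (f ∘ suc) (Finₚ.suc-injective ∘ f-inj) P Q (f[P]⊆Q ∘ there)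
injective⇒∣p∣≤∣q∣ f f-inj (inside  ∷ P) Q f[P]⊆Q = begin
  suc ∣ P ∣         ≤⟨ s≤s (injective⇒∣p∣≤∣q∣ (f ∘ suc) (Finₚ.suc-injective ∘ f-inj) P (Q - f zero) f[P]⊆Q-f0) ⟩
  suc ∣ Q - f zero ∣ ≡⟨ ∣p∣≡1+∣p-x∣ Q (f[P]⊆Q here) ⟨
  ∣ Q ∣             ∎
  where
  open ≤-Reasoning
  f[P]⊆Q-f0 : ∀ {x} → x ∈ P → f (suc x) ∈ Q - f zero
  f[P]⊆Q-f0 x∈P = x∈p∧x≢y⇒x∈p-y (f[P]⊆Q (there x∈P)) (λ eq → Finₚ.0≢1+n (sym (f-inj eq)))

↑ˡ-or-↑ʳ : ∀ p q (x : Fin (p + q)) → (∃ λ i → i ↑ˡ q ≡ x) ⊎ (∃ λ j → p ↑ʳ j ≡ x)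
↑ˡ-or-↑ʳ p q x with splitAt p x in eq
... | inj₁ i = inj₁ (i , Finₚ.splitAt⁻¹-↑ˡ eq)
... | inj₂ j = inj₂ (j , Finₚ.splitAt⁻¹-↑ʳ eq)

take-++ : ∀ (U : Subset p) (V : Subset q) → take p (U ++ V) ≡ U
take-++ {p} U V = ++-injectiveˡ (take p (U ++ V)) U (take++drop≡id p (U ++ V))

drop-++ : ∀ (U : Subset p) (V : Subset q) → drop p (U ++ V) ≡ V
drop-++ {p} U V = ++-injectiveʳ (take p (U ++ V)) U (take++drop≡id p (U ++ V))

∀-++ : ∀ (P : Subset (p + q) → Set) → (∀ U V → P (U ++ V)) → ∀ W → P W
∀-++ {p} P P[U++V] W = subst P (take++drop≡id p W) (P[U++V] (take p W) (drop p W))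

++-ext : ∀ {W : Subset (p + q)} {U V} → (∀ i → lookup W (i ↑ˡ q) ≡ lookup U i) →
         (∀ j → lookup W (p ↑ʳ j) ≡ lookup V j) → W ≡ U ++ V
++-ext {p} {q} {W} {U} {V} on-U on-V = Pointwise-≡⇒≡ (ext pointwise)
  where
  pointwise : ∀ x → lookup W x ≡ lookup (U ++ V) x
  pointwise x with ↑ˡ-or-↑ʳ p q x
  ... | inj₁ (i , refl) = trans (on-U i) (sym (lookup-++ˡ U V i))
  ... | inj₂ (j , refl) = trans (on-V j) (sym (lookup-++ʳ U V j))

∣++∣ : ∀ (U : Subset p) (V : Subset q) → ∣ U ++ V ∣ ≡ ∣ U ∣ + ∣ V ∣
∣++∣ []            V = refl
∣++∣ (inside  ∷ U) V = cong suc (∣++∣ U V)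
∣++∣ (outside ∷ U) V = ∣++∣ U V

∣++∅∣ : ∀ (U : Subset p) → ∣ U ++ ∅ {q} ∣ ≡ ∣ U ∣
∣++∅∣ {q = q} U = trans (∣++∣ U ∅) (trans (cong (∣ U ∣ +_) (∣⊥∣≡0 q)) (+-identityʳ ∣ U ∣))

∅++∅ : ∀ p → ∅ {p} ++ ∅ {q} ≡ ∅
∅++∅ zero    = refl
∅++∅ (suc p) = cong (outside ∷_) (∅++∅ p)

∩-++ : ∀ (U U′ : Subset p) (V V′ : Subset q) → (U ++ V) ∩ (U′ ++ V′) ≡ (U ∩ U′) ++ (V ∩ V′)
∩-++ U U′ V V′ = zipWith-++ _ U V U′ V′

∪-++ : ∀ (U U′ : Subset p) (V V′ : Subset q) → (U ++ V) ∪ (U′ ++ V′) ≡ (U ∪ U′) ++ (V ∪ V′)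
∪-++ U U′ V V′ = zipWith-++ _ U V U′ V′

─-++ : ∀ (U U′ : Subset p) (V V′ : Subset q) → (U ++ V) ─ (U′ ++ V′) ≡ (U ─ U′) ++ (V ─ V′)
─-++ U U′ V V′ = zipWith-++ _ U V U′ V′

∈-++⁺ˡ : ∀ {i} {U : Subset p} (V : Subset q) → i ∈ U → i ↑ˡ q ∈ U ++ V
∈-++⁺ˡ V here      = here
∈-++⁺ˡ V (there h) = there (∈-++⁺ˡ V h)

∈-++⁺ʳ : ∀ {j} (U : Subset p) {V : Subset q} → j ∈ V → p ↑ʳ j ∈ U ++ V
∈-++⁺ʳ []      h = h
∈-++⁺ʳ (_ ∷ U) h = there (∈-++⁺ʳ U h)

∈-++⁻ˡ : ∀ {i} (U : Subset p) {V : Subset q} → i ↑ˡ q ∈ U ++ V → i ∈ U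
∈-++⁻ˡ {i = zero}  (_ ∷ U) here      = here
∈-++⁻ˡ {i = suc i} (_ ∷ U) (there h) = there (∈-++⁻ˡ U h)

∈-++⁻ʳ : ∀ {j} (U : Subset p) {V : Subset q} → p ↑ʳ j ∈ U ++ V → j ∈ V
∈-++⁻ʳ []      h         = h
∈-++⁻ʳ (_ ∷ U) (there h) = ∈-++⁻ʳ U h

⊆-++⁺ : ∀ {U U′ : Subset p} {V V′ : Subset q} → U ⊆ U′ → V ⊆ V′ → U ++ V ⊆ U′ ++ V′
⊆-++⁺ {p} {q} {U} {U′} {V} {V′} U⊆U′ V⊆V′ {x} x∈ with ↑ˡ-or-↑ʳ p q x
... | inj₁ (i , refl) = ∈-++⁺ˡ V′ (U⊆U′ (∈-++⁻ˡ U x∈))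
... | inj₂ (j , refl) = ∈-++⁺ʳ U′ (V⊆V′ (∈-++⁻ʳ U x∈))

⊆-++⁻ˡ : ∀ {U U′ : Subset p} {V V′ : Subset q} → U ++ V ⊆ U′ ++ V′ → U ⊆ U′
⊆-++⁻ˡ {U = U} {U′} {V} {V′} UV⊆ i∈U = ∈-++⁻ˡ U′ (UV⊆ (∈-++⁺ˡ V i∈U))

⊆-++⁻ʳ : ∀ {U U′ : Subset p} {V V′ : Subset q} → U ++ V ⊆ U′ ++ V′ → V ⊆ V′
⊆-++⁻ʳ {U = U} {U′} UV⊆ j∈V = ∈-++⁻ʳ U′ (UV⊆ (∈-++⁺ʳ U j∈V))

++∅⊆++ : ∀ (U : Subset p) {V : Subset q} → U ++ ∅ ⊆ U ++ V
++∅⊆++ U = ⊆-++⁺ {U = U} (λ x∈ → x∈) ⊥⊆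

⊆-++∅ : ∀ {W : Subset (p + q)} {U : Subset p} → W ⊆ U ++ ∅ → W ≡ take p W ++ ∅
⊆-++∅ {p} {W = W} W⊆ = trans (sym (take++drop≡id p W)) (cong (take p W ++_) drop≡∅)
  where
  drop≡∅ : drop p W ≡ ∅
  drop≡∅ = ⊆-antisym (⊆-++⁻ʳ (subst (_⊆ _) (sym (take++drop≡id p W)) W⊆)) ⊥⊆

⁅↑ˡ⁆ : ∀ (i : Fin p) → ⁅ i ↑ˡ q ⁆ ≡ ⁅ i ⁆ ++ ∅ {q}
⁅↑ˡ⁆ {suc p} zero    = cong (inside ∷_) (sym (∅++∅ p))
⁅↑ˡ⁆         (suc i) = cong (outside ∷_) (⁅↑ˡ⁆ i)

⁅↑ʳ⁆ : ∀ p (j : Fin q) → ⁅ p ↑ʳ j ⁆ ≡ ∅ {p} ++ ⁅ j ⁆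
⁅↑ʳ⁆ zero    j = refl
⁅↑ʳ⁆ (suc p) j = cong (outside ∷_) (⁅↑ʳ⁆ p j)

∈-take⁺ : ∀ {i} {W : Subset (p + q)} → i ↑ˡ q ∈ W → i ∈ take p W
∈-take⁺ {p} {W = W} i∈W = ∈-++⁻ˡ (take p W) (subst (_ ∈_) (sym (take++drop≡id p W)) i∈W)

∈-take⁻ : ∀ {i} {W : Subset (p + q)} → i ∈ take p W → i ↑ˡ q ∈ W
∈-take⁻ {p} {W = W} i∈ = subst (_ ∈_) (take++drop≡id p W) (∈-++⁺ˡ (drop p W) i∈)

∈-drop⁺ : ∀ {j} {W : Subset (p + q)} → p ↑ʳ j ∈ W → j ∈ drop p W
∈-drop⁺ {p} {W = W} j∈W = ∈-++⁻ʳ (take p W) (subst (_ ∈_) (sym (take++drop≡id p W)) j∈W)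

∈-++-second : ∀ {S : Subset (p + q)} {x} → (∀ i → i ↑ˡ q ∉ S) → x ∈ S → ∃ λ j → p ↑ʳ j ∈ S
∈-++-second {p} {q} {x = x} none-first x∈S with ↑ˡ-or-↑ʳ p q x
... | inj₁ (i , refl) = ⊥-elim (none-first i x∈S)
... | inj₂ (j , refl) = j , x∈S

firstBlock : ∀ p q → Subset (p + q)
firstBlock p q = full {p} ++ ∅ {q}

lookup-firstBlock-↑ˡ : ∀ (i : Fin p) → lookup (firstBlock p q) (i ↑ˡ q) ≡ true
lookup-firstBlock-↑ˡ i = trans (lookup-++ˡ full ∅ i) (lookup-replicate i true)

lookup-firstBlock-↑ʳ : ∀ (j : Fin q) → lookup (firstBlock p q) (p ↑ʳ j) ≡ false
lookup-firstBlock-↑ʳ {p = p} j = trans (lookup-++ʳ (full {p}) ∅ j) (lookup-replicate j false)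

firstBlock-true⇒↑ˡ : ∀ (x : Fin (p + q)) → lookup (firstBlock p q) x ≡ true → ∃ λ i → i ↑ˡ q ≡ x
firstBlock-true⇒↑ˡ {p} {q} x in-first with ↑ˡ-or-↑ʳ p q x
... | inj₁ left = left
... | inj₂ (j , refl) with () ← trans (sym in-first) (lookup-firstBlock-↑ʳ {p = p} j)

firstBlock-false⇒↑ʳ : ∀ (x : Fin (p + q)) → lookup (firstBlock p q) x ≡ false → ∃ λ j → p ↑ʳ j ≡ x
firstBlock-false⇒↑ʳ {p} {q} x not-first with ↑ˡ-or-↑ʳ p q x
... | inj₂ right = right
... | inj₁ (i , refl) with () ← trans (sym not-first) (lookup-firstBlock-↑ˡ i)

firstBlock≡⁅↑ˡ⁆ : ∀ (i : Fin p) → (∀ x y → y ≡ x) → firstBlock p q ≡ ⁅ i ↑ˡ q ⁆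
firstBlock≡⁅↑ˡ⁆ i subsingleton = trans (cong (_++ ∅) (full≡⁅x⁆ (subsingleton i))) (sym (⁅↑ˡ⁆ i))

↑ˡ∈firstBlock : ∀ (i : Fin p) → i ↑ˡ q ∈ firstBlock p q
↑ˡ∈firstBlock i = ∈-++⁺ˡ ∅ ∈⊤

∈firstBlock⇒↑ˡ : ∀ {x : Fin (p + q)} → x ∈ firstBlock p q → ∃ λ i → i ↑ˡ q ≡ x
∈firstBlock⇒↑ˡ {x = x} x∈ = firstBlock-true⇒↑ˡ x ([]=⇒lookup x∈)

+-∸-≤ : ∀ {j x y u v} → j ≤ u → x ≤ v → y ∸ x ≤ u ∸ j → j + y ≤ u + v
+-∸-≤ {j} {x} {y} {u} {v} j≤u x≤v y∸x≤ = begin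
  j + y               ≤⟨ +-monoʳ-≤ j (m≤n+m∸n y x) ⟩
  j + (x + (y ∸ x))   ≤⟨ +-monoʳ-≤ j (+-mono-≤ x≤v y∸x≤) ⟩
  j + (v + (u ∸ j))   ≡⟨ cong (j +_) (+-comm v (u ∸ j)) ⟩
  j + ((u ∸ j) + v)   ≡⟨ +-assoc j (u ∸ j) v ⟨
  (j + (u ∸ j)) + v   ≡⟨ cong (_+ v) (m+[n∸m]≡n j≤u) ⟩
  u + v               ∎
  where open ≤-Reasoning

m+[n+[o∸m]]≡o+n : ∀ {m o} n → m ≤ o → m + (n + (o ∸ m)) ≡ o + n
m+[n+[o∸m]]≡o+n {m} {o} n m≤o = begin-equality
  m + (n + (o ∸ m))   ≡⟨ cong (m +_) (+-comm n (o ∸ m)) ⟩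
  m + ((o ∸ m) + n)   ≡⟨ +-assoc m (o ∸ m) n ⟨
  (m + (o ∸ m)) + n   ≡⟨ cong (_+ n) (m+[n∸m]≡n m≤o) ⟩
  o + n               ∎
  where open ≤-Reasoning

∸∸≤∸⇔+≤ : ∀ {u v l f} → u ≤ l → l ≤ f → (v ∸ (f ∸ l) ≤ l ∸ u ⇔ u + v ≤ f)
∸∸≤∸⇔+≤ {u} {v} {l} {f} u≤l l≤f = mk⇔
  (λ le → subst (_≤ f) (+-comm v u) (m≤o∸n⇒m+n≤o v u≤f
             (≤-trans (m≤n+m∸n v (f ∸ l)) (≤-trans (+-monoʳ-≤ (f ∸ l) le) (≤-reflexive f∸u)))))
  (λ le → m≤n+o⇒m∸n≤o v (f ∸ l) (≤-trans (m+n≤o⇒m≤o∸n v (subst (_≤ f) (+-comm u v) le)) (≤-reflexive (sym f∸u))))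
  where
  u≤f : u ≤ f
  u≤f = ≤-trans u≤l l≤f
  f∸u : (f ∸ l) + (l ∸ u) ≡ f ∸ u
  f∸u = begin
    (f ∸ l) + (l ∸ u)  ≡⟨ +-∸-assoc (f ∸ l) u≤l ⟨
    (f ∸ l) + l ∸ u    ≡⟨ cong (_∸ u) (m∸n+n≡m l≤f) ⟩
    f ∸ u              ∎
    where open ≡-Reasoning

∧≡true⁻ : ∀ {x y} → x ∧ y ≡ true → x ≡ true × y ≡ true
∧≡true⁻ {true} y≡true = refl , y≡true

≡true-ext : ∀ {x y} → (x ≡ true → y ≡ true) → (y ≡ true → x ≡ true) → x ≡ y
≡true-ext {true}  {true}  _ _ = refl
≡true-ext {true}  {false} f _ = sym (f refl)
≡true-ext {false} {true}  _ g = g refl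
≡true-ext {false} {false} _ _ = refl

≥ᵇ⇒≥ : ∀ {x y} → (x ≥ᵇ y) ≡ true → y ≤ x
≥ᵇ⇒≥ {x} {y} x≥ᵇy with y ≤? x
... | yes y≤x = y≤x

≥⇒≥ᵇ : ∀ {x y} → y ≤ x → (x ≥ᵇ y) ≡ true
≥⇒≥ᵇ {x} {y} y≤x with y ≤? x
... | yes _   = refl
... | no  y≰x = contradiction y≤x y≰x

-- Rank and bases

subsets-complete : ∀ (A : Subset n) → A ∈ₗ subsets n
subsets-complete []            = Any.here refl
subsets-complete (outside ∷ A) = ∈ₗ-++⁺ˡ (∈-map⁺ (outside ∷_) (subsets-complete A))
subsets-complete {suc n} (inside ∷ A) =
  ∈ₗ-++⁺ʳ (map (outside ∷_) (subsets n)) (∈-map⁺ (inside ∷_) (subsets-complete A))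

≤maxℕ : ∀ {x} xs → x ∈ₗ xs → x ≤ maxℕ xs
≤maxℕ (y ∷ xs) (Any.here refl) = m≤m⊔n y _
≤maxℕ (y ∷ xs) (Any.there x∈)  = ≤-trans (≤maxℕ xs x∈) (m≤n⊔m y _)

maxℕ≡0⊎maxℕ∈ : ∀ xs → maxℕ xs ≡ 0 ⊎ maxℕ xs ∈ₗ xs
maxℕ≡0⊎maxℕ∈ []       = inj₁ refl
maxℕ≡0⊎maxℕ∈ (y ∷ xs) with ⊔-sel y (maxℕ xs) | maxℕ≡0⊎maxℕ∈ xs
... | inj₁ ≡y | _          = inj₂ (Any.here ≡y)
... | inj₂ ≡m | inj₁ m≡0   = inj₁ (trans ≡m m≡0)
... | inj₂ ≡m | inj₂ m∈xs  = inj₂ (Any.there (subst (_∈ₗ xs) (sym ≡m) m∈xs))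

IsBasis : IndSys n → Subset n → Subset n → Set
IsBasis I A B = B ⊆ A × I B ≡ true × ∣ B ∣ ≡ rank I A

module _ (I : IndSys n) where

  private
    independent-in : ∀ A J → Dec (J ⊆ A × I J ≡ true)
    independent-in A J = (J ⊆? A) ×-dec (I J ≟ᵇ true)

  ∣indep∣≤rank : ∀ {A J} → J ⊆ A → I J ≡ true → ∣ J ∣ ≤ rank I A
  ∣indep∣≤rank {A} {J} J⊆A IJ =
    ≤maxℕ _ (∈-map⁺ ∣_∣ (∈-filter⁺ (independent-in A) (subsets-complete J) (J⊆A , IJ)))

  basis : I ∅ ≡ true → ∀ A → ∃ (IsBasis I A)
  basis I∅ A with maxℕ≡0⊎maxℕ∈ (map ∣_∣ (filter (independent-in A) (subsets n)))
  ... | inj₁ rank≡0 = ∅ , ⊥⊆ , I∅ , trans (∣⊥∣≡0 n) (sym rank≡0)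
  ... | inj₂ rank∈ with ∈-map⁻ ∣_∣ rank∈
  ... | J , J∈ , rank≡∣J∣ with ∈-filter⁻ (independent-in A) {xs = subsets n} J∈
  ... | _ , J⊆A , IJ = J , J⊆A , IJ , sym rank≡∣J∣

  basis-maximal : ∀ {A B x} → IsBasis I A B → x ∉ B → x ∈ A → I (B ∪ ⁅ x ⁆) ≢ true
  basis-maximal {A} {B} {x} (B⊆A , _ , ∣B∣) x∉B x∈A IBx = <-irrefl refl (begin-strict
    rank I A         ≡⟨ ∣B∣ ⟨
    ∣ B ∣            <⟨ n<1+n _ ⟩
    suc ∣ B ∣        ≡⟨ ∣p∪⁅x⁆∣≡1+∣p∣ B x∉B ⟨
    ∣ B ∪ ⁅ x ⁆ ∣    ≤⟨ ∣indep∣≤rank (∪⁅⁆-⊆ B⊆A x∈A) IBx ⟩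
    rank I A         ∎)
    where open ≤-Reasoning

  module _ (I∅ : I ∅ ≡ true) where

    rank-mono : ∀ {A A′} → A ⊆ A′ → rank I A ≤ rank I A′
    rank-mono {A} A⊆A′ with basis I∅ A
    ... | B , B⊆A , IB , ∣B∣ = subst (_≤ _) ∣B∣ (∣indep∣≤rank (⊆-trans B⊆A A⊆A′) IB)

    rank≤∣∣ : ∀ A → rank I A ≤ ∣ A ∣
    rank≤∣∣ A with basis I∅ A
    ... | B , B⊆A , _ , ∣B∣ = subst (_≤ ∣ A ∣) ∣B∣ (p⊆q⇒∣p∣≤∣q∣ B⊆A)

    indep⇒rank≡∣∣ : ∀ {J} → I J ≡ true → rank I J ≡ ∣ J ∣
    indep⇒rank≡∣∣ {J} IJ = ≤-antisym (rank≤∣∣ J) (∣indep∣≤rank ⊆-refl IJ)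

    ∣∣≤rank⇒indep : ∀ {J} → ∣ J ∣ ≤ rank I J → I J ≡ true
    ∣∣≤rank⇒indep {J} ∣J∣≤ with basis I∅ J
    ... | B , B⊆J , IB , ∣B∣ rewrite ⊆∧∣q∣≤∣p∣⇒p≡q B⊆J (subst (∣ J ∣ ≤_) (sym ∣B∣) ∣J∣≤) = IB

    ∣∣≡∧rank≡⇒indep≡ : ∀ {W W′} → ∣ W ∣ ≡ ∣ W′ ∣ → rank I W ≡ rank I W′ → I W ≡ I W′
    ∣∣≡∧rank≡⇒indep≡ ∣W∣≡ rank≡ = ≡true-ext
      (λ IW → ∣∣≤rank⇒indep (subst₂ _≤_ ∣W∣≡ rank≡ (≤-reflexive (sym (indep⇒rank≡∣∣ IW)))))
      (λ IW′ → ∣∣≤rank⇒indep (subst₂ _≤_ (sym ∣W∣≡) (sym rank≡) (≤-reflexive (sym (indep⇒rank≡∣∣ IW′)))))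

basis-++ : ∀ {p q} (I : IndSys (p + q)) → I ∅ ≡ true → ∀ A →
           ∃₂ λ (B₁ : Subset p) (B₂ : Subset q) → IsBasis I A (B₁ ++ B₂)
basis-++ {p} I I∅ A with B , isB ← basis I I∅ A =
  take p B , drop p B , subst (IsBasis I A) (sym (take++drop≡id p B)) isB

module _ (σ : Fin n ↔ Fin m) where

  lookup-image : ∀ (A : Subset n) j → lookup (image σ A) j ≡ lookup A (σ ⟨$⟩ˡ j)
  lookup-image A j = lookup∘tabulate _ j

  ∈-image⁻ : ∀ {A y} → y ∈ image σ A → σ ⟨$⟩ˡ y ∈ A
  ∈-image⁻ {A} {y} y∈ = lookup⇒[]= (σ ⟨$⟩ˡ y) A (trans (sym (lookup-image A y)) ([]=⇒lookup y∈))

  ∈-image⁺ : ∀ {A x} → x ∈ A → σ ⟨$⟩ʳ x ∈ image σ A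
  ∈-image⁺ {A} {x} x∈ = lookup⇒[]= (σ ⟨$⟩ʳ x) (image σ A)
    (trans (lookup-image A _) (trans (cong (lookup A) (inverseˡ σ)) ([]=⇒lookup x∈)))

  image-⊆ : ∀ {A B} → A ⊆ B → image σ A ⊆ image σ B
  image-⊆ A⊆B y∈ = subst (_∈ _) (inverseʳ σ) (∈-image⁺ (A⊆B (∈-image⁻ y∈)))

  image-zipWith : ∀ f (A B : Subset n) → image σ (zipWith f A B) ≡ zipWith f (image σ A) (image σ B)
  image-zipWith f A B = Pointwise-≡⇒≡ (ext λ j → begin
    lookup (image σ (zipWith f A B)) j                 ≡⟨ lookup-image (zipWith f A B) j ⟩
    lookup (zipWith f A B) (σ ⟨$⟩ˡ j)                  ≡⟨ lookup-zipWith f _ A B ⟩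
    f (lookup A (σ ⟨$⟩ˡ j)) (lookup B (σ ⟨$⟩ˡ j))       ≡⟨ cong₂ f (lookup-image A j) (lookup-image B j) ⟨
    f (lookup (image σ A) j) (lookup (image σ B) j)     ≡⟨ lookup-zipWith f j (image σ A) (image σ B) ⟨
    lookup (zipWith f (image σ A) (image σ B)) j       ∎)
    where open ≡-Reasoning

  image-replicate : ∀ b → image σ (replicate n b) ≡ replicate m b
  image-replicate b = Pointwise-≡⇒≡ (ext λ j →
    trans (lookup-image (replicate n b) j) (trans (lookup-replicate (σ ⟨$⟩ˡ j) b) (sym (lookup-replicate j b))))

  image-⁅⁆ : ∀ x → image σ ⁅ x ⁆ ≡ ⁅ σ ⟨$⟩ʳ x ⁆
  image-⁅⁆ x = Pointwise-≡⇒≡ (ext λ j → trans (lookup-image ⁅ x ⁆ j) (pointwise j))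
    where
    pointwise : ∀ j → lookup ⁅ x ⁆ (σ ⟨$⟩ˡ j) ≡ lookup ⁅ σ ⟨$⟩ʳ x ⁆ j
    pointwise j with j ≟ σ ⟨$⟩ʳ x
    ... | yes refl = trans (cong (lookup ⁅ x ⁆) (inverseˡ σ)) (trans (lookup-⁅x⁆ x) (sym (lookup-⁅x⁆ (σ ⟨$⟩ʳ x))))
    ... | no  j≢σx = trans (lookup-⁅y⁆ x (λ eq → j≢σx (trans (sym (inverseʳ σ)) (cong (σ ⟨$⟩ʳ_) eq))))
                           (sym (lookup-⁅y⁆ _ j≢σx))

  image-flip : ∀ A → image (flip σ) (image σ A) ≡ A
  image-flip A = Pointwise-≡⇒≡ (ext λ i →
    trans (lookup∘tabulate _ i) (trans (lookup-image A _) (cong (lookup A) (inverseˡ σ))))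

  ∣image∣ : ∀ A → ∣ image σ A ∣ ≡ ∣ A ∣
  ∣image∣ A = ≤-antisym
    (injective⇒∣p∣≤∣q∣ (σ ⟨$⟩ˡ_) (Injection.injective (↔⇒↣ (flip σ))) (image σ A) A ∈-image⁻)
    (injective⇒∣p∣≤∣q∣ (σ ⟨$⟩ʳ_) (Injection.injective (↔⇒↣ σ)) A (image σ A) ∈-image⁺)

image-∘ₚ : ∀ (σ : Fin n ↔ Fin m) (τ : Fin m ↔ Fin k) A → image τ (image σ A) ≡ image (σ ∘ₚ τ) A
image-∘ₚ σ τ A = Pointwise-≡⇒≡ (ext λ i →
  trans (lookup-image τ (image σ A) i) (trans (lookup-image σ A _) (sym (lookup-image (σ ∘ₚ τ) A i))))

image-id : ∀ (A : Subset n) → image Perm.id A ≡ A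
image-id A = Pointwise-≡⇒≡ (ext (lookup-image Perm.id A))

image-flip′ : ∀ (σ : Fin n ↔ Fin m) B → image σ (image (flip σ) B) ≡ B
image-flip′ σ = image-flip (flip σ)

≅ᵢ-sym : ∀ {I : IndSys n} {J : IndSys m} → I ≅ᵢ J → J ≅ᵢ I
≅ᵢ-sym {J = J} (σ , I≡J) = flip σ , λ B → trans (cong J (sym (image-flip′ σ B))) (sym (I≡J (image (flip σ) B)))

≅ᵢ-trans : ∀ {I : IndSys n} {J : IndSys m} {L : IndSys k} → I ≅ᵢ J → J ≅ᵢ L → I ≅ᵢ L
≅ᵢ-trans {L = L} (σ , I≡J) (τ , J≡L) = σ ∘ₚ τ , λ A → trans (I≡J A) (trans (J≡L _) (cong L (image-∘ₚ σ τ A)))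

≅ᵢ-∅ : ∀ {I : IndSys n} {J : IndSys m} → I ≅ᵢ J → I ∅ ≡ true → J ∅ ≡ true
≅ᵢ-∅ {J = J} (σ , I≡J) I∅ = trans (cong J (sym (image-replicate σ false))) (trans (sym (I≡J ∅)) I∅)

≗⇒≅ᵢ : ∀ {I J : IndSys n} → (∀ A → I A ≡ J A) → I ≅ᵢ J
≗⇒≅ᵢ {J = J} I≗J = Perm.id , λ A → trans (I≗J A) (cong J (sym (image-id A)))

rank≤rank-image : ∀ {I : IndSys n} {J : IndSys m} → I ∅ ≡ true → ((σ , _) : I ≅ᵢ J) → ∀ A →
                  rank I A ≤ rank J (image σ A)
rank≤rank-image {I = I} {J} I∅ (σ , I≡J) A with basis I I∅ A
... | B , B⊆A , IB , ∣B∣ = subst₂ _≤_ (trans (∣image∣ σ B) ∣B∣) refl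
                             (∣indep∣≤rank J (image-⊆ σ B⊆A) (trans (sym (I≡J B)) IB))

rank-≅ᵢ : ∀ {I : IndSys n} {J : IndSys m} → I ∅ ≡ true → ((σ , _) : I ≅ᵢ J) → ∀ A →
          rank I A ≡ rank J (image σ A)
rank-≅ᵢ {I = I} {J} I∅ iso@(σ , _) A = ≤-antisym (rank≤rank-image I∅ iso A)
  (subst (rank J (image σ A) ≤_) (cong (rank I) (image-flip σ A))
     (rank≤rank-image (≅ᵢ-∅ {I = I} {J} iso I∅) (≅ᵢ-sym {I = I} {J} iso) (image σ A)))

-- Matroids, their restrictions and contractions

record IsMatroid (I : IndSys n) : Set where
  field
    ∅-independent : I ∅ ≡ true
    hereditary    : ∀ A B → A ⊆ B → I B ≡ true → I A ≡ true
    augmentation  : ∀ A B → I A ≡ true → I B ≡ true → ∣ A ∣ < ∣ B ∣ →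
                    ∃ λ x → x ∈ B × x ∉ A × I (A ∪ ⁅ x ⁆) ≡ true

isMatroid : (M : Matroid) → IsMatroid (indep M)
isMatroid M = record { ∅-independent = indep-∅ M ; hereditary = indep-⊆ M ; augmentation = indep-aug M }

matroid : {I : IndSys n} → IsMatroid I → Matroid
matroid {n} {I} isM = record
  { size = n ; indep = I
  ; indep-∅ = ∅-independent ; indep-⊆ = hereditary ; indep-aug = augmentation }
  where open IsMatroid isM

IsMatroid-≅ᵢ : ∀ {I : IndSys n} {J : IndSys m} → I ≅ᵢ J → IsMatroid J → IsMatroid I
IsMatroid-≅ᵢ {I = I} {J} iso@(σ , I≡J) isM = record
  { ∅-independent = ≅ᵢ-∅ {I = J} {I} (≅ᵢ-sym {I = I} {J} iso) ∅-independent
  ; hereditary    = λ A B A⊆B IB → trans (I≡J A) (hereditary _ _ (image-⊆ σ A⊆B) (trans (sym (I≡J B)) IB))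
  ; augmentation  = augment }
  where
  open IsMatroid isM
  augment : ∀ A B → I A ≡ true → I B ≡ true → ∣ A ∣ < ∣ B ∣ →
            ∃ λ x → x ∈ B × x ∉ A × I (A ∪ ⁅ x ⁆) ≡ true
  augment A B IA IB ∣A∣<∣B∣
    with y , y∈σB , y∉σA , Jσ[A+y] ← augmentation (image σ A) (image σ B) (trans (sym (I≡J A)) IA)
           (trans (sym (I≡J B)) IB) (subst₂ _<_ (sym (∣image∣ σ A)) (sym (∣image∣ σ B)) ∣A∣<∣B∣)
    = σ ⟨$⟩ˡ y , ∈-image⁻ σ y∈σB
    , (λ σ⁻¹y∈A → y∉σA (subst (_∈ image σ A) (inverseʳ σ) (∈-image⁺ σ σ⁻¹y∈A)))
    , trans (I≡J _) (trans (cong J image-A+y) Jσ[A+y])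
    where
    image-A+y : image σ (A ∪ ⁅ σ ⟨$⟩ˡ y ⁆) ≡ image σ A ∪ ⁅ y ⁆
    image-A+y = trans (image-zipWith σ _∨_ A _) (cong (image σ A ∪_) (trans (image-⁅⁆ σ _) (cong ⁅_⁆ (inverseʳ σ))))

module _ {I : IndSys n} (isM : IsMatroid I) where
  open IsMatroid isM

  private
    extend-by : ∀ d {A J} → J ⊆ A → I J ≡ true → ∣ J ∣ + d ≡ rank I A →
                ∃ λ B → J ⊆ B × IsBasis I A B
    extend-by zero    {J = J} J⊆A IJ eq = J , id , J⊆A , IJ , trans (sym (+-identityʳ _)) eq
    extend-by (suc d) {A} {J} J⊆A IJ eq with basis I ∅-independent A
    ... | B , B⊆A , IB , ∣B∣ with augmentation J B IJ IB (subst (∣ J ∣ <_) (trans eq (sym ∣B∣)) (m<m+n _ z<s))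
    ... | x , x∈B , x∉J , IJx with extend-by d (∪⁅⁆-⊆ J⊆A (B⊆A x∈B)) IJx
                                      (trans (cong (_+ d) (∣p∪⁅x⁆∣≡1+∣p∣ J x∉J)) (trans (sym (+-suc _ d)) eq))
    ... | B′ , J+x⊆B′ , isBasis = B′ , J+x⊆B′ ∘ p⊆p∪q ⁅ x ⁆ , isBasis

  extend-to-basis : ∀ {A J} → J ⊆ A → I J ≡ true → ∃ λ B → J ⊆ B × IsBasis I A B
  extend-to-basis J⊆A IJ = extend-by _ J⊆A IJ (m+[n∸m]≡n (∣indep∣≤rank I J⊆A IJ))

  basis-spans : ∀ {L B} → IsBasis I L B → ∀ Z → rank I (L ∪ Z) ≤ rank I (B ∪ Z)
  basis-spans {L} {B} isB@(B⊆L , IB , _) Z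
    with J , B⊆J , isJ@(J⊆B∪Z , IJ , ∣J∣) ← extend-to-basis (p⊆p∪q Z) IB
    with J′ , _ , J′⊆L∪Z , IJ′ , ∣J′∣ ← extend-to-basis (⊆-trans J⊆B∪Z (∪-monoˡ-⊆ B⊆L)) IJ
    with ∣ J′ ∣ ≤? ∣ J ∣
  ... | yes ∣J′∣≤∣J∣ = subst₂ _≤_ ∣J′∣ ∣J∣ ∣J′∣≤∣J∣
  ... | no  ∣J′∣≰∣J∣ with augmentation J J′ IJ IJ′ (≰⇒> ∣J′∣≰∣J∣)
  ... | x , x∈J′ , x∉J , IJx with x∈p∪q⁻ L Z (J′⊆L∪Z x∈J′)
  ...   | inj₁ x∈L = ⊥-elim (basis-maximal I isB (x∉J ∘ B⊆J) x∈L
                               (hereditary _ _ (∪-monoˡ-⊆ B⊆J) IJx))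
  ...   | inj₂ x∈Z = ⊥-elim (basis-maximal I isJ x∉J (q⊆p∪q B Z x∈Z) IJx)

rank-restrict : ∀ {I : IndSys (p + q)} {J : IndSys p} → I ∅ ≡ true → (∀ U → I (U ++ ∅) ≡ J U) →
                ∀ U → rank I (U ++ ∅ {q}) ≡ rank J U
rank-restrict {p} {q} {I} {J} I∅ I≡J U
  with W , W⊆U∅ , IW , ∣W∣ ← basis I I∅ (U ++ ∅)
  with B , B⊆U , JB , ∣B∣ ← basis J (trans (sym (I≡J ∅)) (trans (cong I (∅++∅ p)) I∅)) U
  = ≤-antisym rank-I≤rank-J rank-J≤rank-I
  where
  W≡ : W ≡ take p W ++ ∅
  W≡ = ⊆-++∅ {p} {q} {U = U} W⊆U∅
  rank-I≤rank-J : rank I (U ++ ∅) ≤ rank J U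
  rank-I≤rank-J = subst (_≤ rank J U) (trans (sym (∣++∅∣ (take p W))) (trans (cong ∣_∣ (sym W≡)) ∣W∣))
    (∣indep∣≤rank J (⊆-++⁻ˡ (subst (_⊆ _) W≡ W⊆U∅)) (trans (sym (I≡J _)) (trans (cong I (sym W≡)) IW)))
  rank-J≤rank-I : rank J U ≤ rank I (U ++ ∅)
  rank-J≤rank-I = subst (_≤ _) (trans (∣++∅∣ B) ∣B∣) (∣indep∣≤rank I (⊆-++⁺ B⊆U ⊆-refl) (trans (I≡J B) JB))

basis-++∅ : ∀ (I : IndSys (p + q)) → I ∅ ≡ true → ∀ U → ∃ λ B → IsBasis I (U ++ ∅) (B ++ ∅)
basis-++∅ {p} {q} I I∅ U with W , isW@(W⊆U∅ , _) ← basis I I∅ (U ++ ∅) =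
  take p W , subst (IsBasis I (U ++ ∅)) (⊆-++∅ {p} {q} {U = U} W⊆U∅) isW

module _ {I : IndSys (p + q)} (isM : IsMatroid I) where
  open IsMatroid isM

  IsMatroid-restrict : IsMatroid (λ U → I (U ++ ∅ {q}))
  IsMatroid-restrict = record
    { ∅-independent = trans (cong I (∅++∅ p)) ∅-independent
    ; hereditary    = λ A B A⊆B IB → hereditary _ _ (⊆-++⁺ A⊆B ⊆-refl) IB
    ; augmentation  = augment }
    where
    augment : ∀ A B → I (A ++ ∅) ≡ true → I (B ++ ∅) ≡ true → ∣ A ∣ < ∣ B ∣ →
              ∃ λ x → x ∈ B × x ∉ A × I ((A ∪ ⁅ x ⁆) ++ ∅) ≡ true
    augment A B IA IB ∣A∣<∣B∣
      with x , x∈B∅ , x∉A∅ , IAx ← augmentation _ _ IA IB (subst₂ _<_ (sym (∣++∅∣ A)) (sym (∣++∅∣ B)) ∣A∣<∣B∣)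
      with ↑ˡ-or-↑ʳ p q x
    ... | inj₂ (j , refl) = ⊥-elim (∉⊥ (∈-++⁻ʳ B x∈B∅))
    ... | inj₁ (i , refl) = i , ∈-++⁻ˡ B x∈B∅ , x∉A∅ ∘ ∈-++⁺ˡ ∅ , subst (λ W → I W ≡ true) A∅+i IAx
      where
      A∅+i : (A ++ ∅) ∪ ⁅ i ↑ˡ q ⁆ ≡ (A ∪ ⁅ i ⁆) ++ ∅
      A∅+i = trans (cong ((A ++ ∅) ∪_) (⁅↑ˡ⁆ i))
                   (trans (∪-++ A ⁅ i ⁆ ∅ ∅) (cong ((A ∪ ⁅ i ⁆) ++_) (∪-identityʳ ∅)))

  module _ {B : Subset p} (IB : I (B ++ ∅) ≡ true) where

    IsMatroid-contract : IsMatroid (λ V → I (B ++ V))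
    IsMatroid-contract = record
      { ∅-independent = IB
      ; hereditary    = λ V V′ V⊆V′ IV′ → hereditary _ _ (⊆-++⁺ ⊆-refl V⊆V′) IV′
      ; augmentation  = augment }
      where
      augment : ∀ V₁ V₂ → I (B ++ V₁) ≡ true → I (B ++ V₂) ≡ true → ∣ V₁ ∣ < ∣ V₂ ∣ →
                ∃ λ x → x ∈ V₂ × x ∉ V₁ × I (B ++ (V₁ ∪ ⁅ x ⁆)) ≡ true
      augment V₁ V₂ I₁ I₂ ∣V₁∣<∣V₂∣
        with x , x∈BV₂ , x∉BV₁ , IBV₁x ← augmentation _ _ I₁ I₂
               (subst₂ _<_ (sym (∣++∣ B V₁)) (sym (∣++∣ B V₂)) (+-monoʳ-< ∣ B ∣ ∣V₁∣<∣V₂∣))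
        with ↑ˡ-or-↑ʳ p q x
      ... | inj₁ (i , refl) = ⊥-elim (x∉BV₁ (∈-++⁺ˡ V₁ (∈-++⁻ˡ B x∈BV₂)))
      ... | inj₂ (j , refl) = j , ∈-++⁻ʳ B x∈BV₂ , x∉BV₁ ∘ ∈-++⁺ʳ B , subst (λ W → I W ≡ true) BV₁+j IBV₁x
        where
        BV₁+j : (B ++ V₁) ∪ ⁅ p ↑ʳ j ⁆ ≡ B ++ (V₁ ∪ ⁅ j ⁆)
        BV₁+j = trans (cong ((B ++ V₁) ∪_) (⁅↑ʳ⁆ p j))
                      (trans (∪-++ B ∅ V₁ ⁅ j ⁆) (cong (_++ (V₁ ∪ ⁅ j ⁆)) (∪-identityʳ B)))

    rank-contract : ∀ V → rank I (B ++ V) ≡ ∣ B ∣ + rank (λ V → I (B ++ V)) V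
    rank-contract V
      with J , B∅⊆J , J⊆BV , IJ , ∣J∣ ← extend-to-basis isM (⊆-++⁺ {U = B} {V = ∅} {V} ⊆-refl ⊥⊆) IB
      with J′ , J′⊆V , IBJ′ , ∣J′∣ ← basis (λ V → I (B ++ V)) IB V
      = ≤-antisym rank-I≤ ≤rank-I
      where
      J≡ : J ≡ B ++ drop p J
      J≡ = trans J≡take++drop (cong (_++ drop p J) take≡B)
        where
        J≡take++drop : J ≡ take p J ++ drop p J
        J≡take++drop = sym (take++drop≡id p J)
        take≡B : take p J ≡ B
        take≡B = ⊆-antisym (⊆-++⁻ˡ (subst (_⊆ _) J≡take++drop J⊆BV)) (⊆-++⁻ˡ (subst (_ ⊆_) J≡take++drop B∅⊆J))
      rank-I≤ : rank I (B ++ V) ≤ ∣ B ∣ + rank (λ V → I (B ++ V)) V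
      rank-I≤ = subst (_≤ ∣ B ∣ + rank (λ V → I (B ++ V)) V)
                      (trans (sym (∣++∣ B (drop p J))) (trans (cong ∣_∣ (sym J≡)) ∣J∣))
        (+-monoʳ-≤ ∣ B ∣ (∣indep∣≤rank (λ V → I (B ++ V)) (⊆-++⁻ʳ {U = B} {B} (subst (_⊆ B ++ V) J≡ J⊆BV))
                                       (trans (cong I (sym J≡)) IJ)))
      ≤rank-I : ∣ B ∣ + rank (λ V → I (B ++ V)) V ≤ rank I (B ++ V)
      ≤rank-I = subst (_≤ rank I (B ++ V)) (trans (∣++∣ B J′) (cong (∣ B ∣ +_) ∣J′∣))
        (∣indep∣≤rank I (⊆-++⁺ {U = B} ⊆-refl J′⊆V) IBJ′)

-- Free products

module _ {a m} (A : IndSys a) (R : IndSys m) where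

  □-++ : ∀ U V → (A □ R) (U ++ V) ≡ A U ∧ (rankLack A U ≥ᵇ nullity R V)
  □-++ U V rewrite take-++ U V | drop-++ U V = refl

  □-indep⁺ : ∀ {U V} → A U ≡ true → nullity R V ≤ rankLack A U → (A □ R) (U ++ V) ≡ true
  □-indep⁺ {U} {V} AU ν≤λ rewrite □-++ U V | AU = ≥⇒≥ᵇ ν≤λ

  □-indep⁻ : ∀ {U V} → (A □ R) (U ++ V) ≡ true → A U ≡ true × nullity R V ≤ rankLack A U
  □-indep⁻ {U} {V} K[UV] with ∧≡true⁻ {A U} (trans (sym (□-++ U V)) K[UV])
  ... | AU , λ≥ᵇν = AU , ≥ᵇ⇒≥ λ≥ᵇν

  □-restrict : ∀ U → (A □ R) (U ++ ∅) ≡ A U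
  □-restrict U = begin
    (A □ R) (U ++ ∅)                          ≡⟨ □-++ U ∅ ⟩
    A U ∧ (rankLack A U ≥ᵇ nullity R ∅)       ≡⟨ cong (λ ν → A U ∧ (rankLack A U ≥ᵇ ν)) nullity-∅ ⟩
    A U ∧ (rankLack A U ≥ᵇ 0)                 ≡⟨ cong (A U ∧_) (≥⇒≥ᵇ {rankLack A U} z≤n) ⟩
    A U ∧ true                                ≡⟨ ∧-identityʳ (A U) ⟩
    A U                                       ∎
    where
    open ≡-Reasoning
    nullity-∅ : nullity R ∅ ≡ 0
    nullity-∅ = trans (cong (_∸ rank R ∅) (∣⊥∣≡0 m)) (0∸n≡0 (rank R ∅))

module _ {a m} {A : IndSys a} {R : IndSys m} (A∅ : A ∅ ≡ true) (R∅ : R ∅ ≡ true) where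

  □-∅ : (A □ R) ∅ ≡ true
  □-∅ = trans (cong (A □ R) (sym (∅++∅ a))) (trans (□-restrict A R ∅) A∅)

  rank-□-restrict : ∀ U → rank (A □ R) (U ++ ∅) ≡ rank A U
  rank-□-restrict = rank-restrict □-∅ (□-restrict A R)

  rankLack-basis : ∀ {U B} → IsBasis A U B → rankLack A B ≡ rankLack A U
  rankLack-basis (_ , AB , ∣B∣) = cong (rank A full ∸_) (trans (indep⇒rank≡∣∣ A A∅ AB) ∣B∣)

  □-contract : ∀ {B} → IsBasis A full B → ∀ V → (A □ R) (B ++ V) ≡ R V
  □-contract {B} isB@(_ , AB , _) V = ≡true-ext
    (λ K[BV] → ∣∣≤rank⇒indep R R∅ (m∸n≡0⇒m≤n (n≤0⇒n≡0 (subst (nullity R V ≤_) λ≡0 (proj₂ (□-indep⁻ A R K[BV]))))))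
    (λ RV → □-indep⁺ A R AB (subst (_≤ rankLack A B) (sym (m≤n⇒m∸n≡0 (≤-reflexive (sym (indep⇒rank≡∣∣ R R∅ RV))))) z≤n))
    where
    λ≡0 : rankLack A B ≡ 0
    λ≡0 = trans (rankLack-basis isB) (n∸n≡0 (rank A full))

  rank-□-full≤ : ∀ V → rank (A □ R) (full ++ V) ≤ rank A full + rank R V
  rank-□-full≤ V
    with W₁ , W₂ , W⊆ , KW , ∣W∣ ← basis-++ (A □ R) □-∅ (full ++ V)
    with AW₁ , ν≤λ ← □-indep⁻ A R {W₁} {W₂} KW
    = subst (_≤ rank A full + rank R V) (trans (sym (∣++∣ W₁ W₂)) ∣W∣)
        (+-∸-≤ {x = rank R W₂} (∣indep∣≤rank A ⊆⊤ AW₁) (rank-mono R R∅ (⊆-++⁻ʳ {U = W₁} W⊆))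
               (subst (λ r → nullity R W₂ ≤ rank A full ∸ r) (indep⇒rank≡∣∣ A A∅ AW₁) ν≤λ))

  rank-□ : ∀ U V → rank A U + ∣ V ∣ ≤ rank (A □ R) (U ++ V) ⊎ rank (A □ R) (full ++ V) ≤ rank (A □ R) (U ++ V)
  rank-□ U V with BU , isBU@(BU⊆U , ABU , ∣BU∣) ← basis A A∅ U | nullity R V ≤? rankLack A U
  ... | yes ν≤λ = inj₁ (subst (_≤ rank (A □ R) (U ++ V)) (trans (∣++∣ BU V) (cong (_+ ∣ V ∣) ∣BU∣))
                          (∣indep∣≤rank (A □ R) (⊆-++⁺ BU⊆U ⊆-refl)
                             (□-indep⁺ A R ABU (subst (nullity R V ≤_) (sym (rankLack-basis isBU)) ν≤λ))))
  ... | no  ν≰λ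
    with BV , BV⊆V , RBV , ∣BV∣ ← basis R R∅ V
    with V′ , BV⊆V′ , V′⊆V , ∣V′∣ ← ⊆-between (rankLack A U) BV⊆V
           (subst (λ r → r + rankLack A U ≤ ∣ V ∣) (sym ∣BV∣)
              (subst (_≤ ∣ V ∣) (+-comm (rankLack A U) (rank R V))
                 (m≤o∸n⇒m+n≤o (rankLack A U) (rank≤∣∣ R R∅ V) (<⇒≤ (≰⇒> ν≰λ)))))
    = inj₂ (begin
      rank (A □ R) (full ++ V)                     ≤⟨ rank-□-full≤ V ⟩
      rank A full + rank R V                       ≡⟨ m+[n+[o∸m]]≡o+n (rank R V) (rank-mono A A∅ ⊆⊤) ⟨
      rank A U + (rank R V + rankLack A U)         ≡⟨ cong₂ _+_ ∣BU∣ (trans ∣V′∣ (cong (_+ rankLack A U) ∣BV∣)) ⟨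
      ∣ BU ∣ + ∣ V′ ∣                               ≡⟨ ∣++∣ BU V′ ⟨
      ∣ BU ++ V′ ∣                                  ≤⟨ ∣indep∣≤rank (A □ R) (⊆-++⁺ BU⊆U V′⊆V) K[BU++V′] ⟩
      rank (A □ R) (U ++ V)                        ∎)
    where
    open ≤-Reasoning
    rank-V′ : rank R V′ ≡ rank R V
    rank-V′ = ≤-antisym (rank-mono R R∅ V′⊆V) (subst (_≤ rank R V′) ∣BV∣ (∣indep∣≤rank R BV⊆V′ RBV))
    nullity-V′ : nullity R V′ ≡ rankLack A U
    nullity-V′ = trans (cong₂ _∸_ (trans ∣V′∣ (cong (_+ rankLack A U) ∣BV∣)) rank-V′)
                       (m+n∸m≡n (rank R V) (rankLack A U))
    K[BU++V′] : (A □ R) (BU ++ V′) ≡ true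
    K[BU++V′] = □-indep⁺ A R ABU (≤-reflexive (trans nullity-V′ (sym (rankLack-basis isBU))))

-- Splits

-- The rank form of "I is the free product of its restriction to S and its contraction by S"
-- (see Split⇒≅□): every X is either free over S or spans S.
Split : IndSys n → Subset n → Set
Split I S = ∀ X → rank I (X ∩ S) + ∣ X ─ S ∣ ≤ rank I X ⊎ rank I (X ∪ S) ≤ rank I X

Split-≅ᵢ : ∀ {I : IndSys n} {J : IndSys m} → J ∅ ≡ true → ((σ , _) : I ≅ᵢ J) → ∀ {S} →
           Split J S → Split I (image (flip σ) S)
Split-≅ᵢ {n} {I = I} {J} J∅ iso@(σ , _) {S} split-J X =
  Sum.map (subst₂ _≤_ ∩─-image (sym (rank-image X))) (subst₂ _≤_ ∪-image (sym (rank-image X)))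
          (split-J (image σ X))
  where
  S′ : Subset n
  S′ = image (flip σ) S
  rank-image : ∀ Y → rank I Y ≡ rank J (image σ Y)
  rank-image = rank-≅ᵢ (≅ᵢ-∅ {I = J} {I} (≅ᵢ-sym {I = I} {J} iso) J∅) iso
  image-op : ∀ f → image σ (zipWith f X S′) ≡ zipWith f (image σ X) S
  image-op f = trans (image-zipWith σ f X S′) (cong (zipWith f (image σ X)) (image-flip′ σ S))
  ∩─-image : rank J (image σ X ∩ S) + ∣ image σ X ─ S ∣ ≡ rank I (X ∩ S′) + ∣ X ─ S′ ∣
  ∩─-image = cong₂ _+_ (trans (cong (rank J) (sym (image-op _))) (sym (rank-image _)))
                       (trans (cong ∣_∣ (sym (image-op _))) (∣image∣ σ (X ─ S′)))
  ∪-image : rank J (image σ X ∪ S) ≡ rank I (X ∪ S′)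
  ∪-image = trans (cong (rank J) (sym (image-op _))) (sym (rank-image _))

module _ {I : IndSys (p + q)} where

  private
    ∩-firstBlock : ∀ (U : Subset p) (V : Subset q) → (U ++ V) ∩ firstBlock p q ≡ U ++ ∅
    ∩-firstBlock U V = trans (∩-++ U full V ∅) (cong₂ _++_ (∩-identityʳ U) (∩-zeroʳ V))

    ∣─firstBlock∣ : ∀ (U : Subset p) (V : Subset q) → ∣ (U ++ V) ─ firstBlock p q ∣ ≡ ∣ V ∣
    ∣─firstBlock∣ U V = trans (cong ∣_∣ (trans (─-++ U full V ∅) (cong₂ _++_ (p─⊤≡⊥ U) (p─⊥≡p V))))
                          (trans (∣++∣ (∅ {p}) V) (cong (_+ ∣ V ∣) (∣⊥∣≡0 p)))

    ∪-firstBlock : ∀ (U : Subset p) (V : Subset q) → (U ++ V) ∪ firstBlock p q ≡ full ++ V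
    ∪-firstBlock U V = trans (∪-++ U full V ∅) (cong₂ _++_ (∪-zeroʳ U) (∪-identityʳ V))

  Split-first-block⁺ : (∀ U V → rank I (U ++ ∅) + ∣ V ∣ ≤ rank I (U ++ V) ⊎ rank I (full ++ V) ≤ rank I (U ++ V)) →
                       Split I (firstBlock p q)
  Split-first-block⁺ split = ∀-++ _ λ U V → Sum.map
    (subst (_≤ rank I (U ++ V)) (sym (cong₂ _+_ (cong (rank I) (∩-firstBlock U V)) (∣─firstBlock∣ U V))))
    (subst (_≤ rank I (U ++ V)) (sym (cong (rank I) (∪-firstBlock U V))))
    (split U V)

  Split-first-block⁻ : Split I (firstBlock p q) →
                       ∀ U V → rank I (U ++ ∅) + ∣ V ∣ ≤ rank I (U ++ V) ⊎ rank I (full ++ V) ≤ rank I (U ++ V)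
  Split-first-block⁻ split U V = Sum.map
    (subst (_≤ rank I (U ++ V)) (cong₂ _+_ (cong (rank I) (∩-firstBlock U V)) (∣─firstBlock∣ U V)))
    (subst (_≤ rank I (U ++ V)) (cong (rank I) (∪-firstBlock U V)))
    (split (U ++ V))

module _ {a m} {A : IndSys a} {R : IndSys m} (A∅ : A ∅ ≡ true) (R∅ : R ∅ ≡ true) where

  Split-□ : Split (A □ R) (firstBlock a m)
  Split-□ = Split-first-block⁺ {a} {m} {A □ R} λ U V →
    Sum.map₁ (subst (λ r → r + ∣ V ∣ ≤ rank (A □ R) (U ++ V)) (sym (rank-□-restrict A∅ R∅ U))) (rank-□ A∅ R∅ U V)

  private
    K : IndSys (a + m)
    K = A □ R
    rank-K : ∀ U → rank K (U ++ ∅) ≡ rank A U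
    rank-K = rank-□-restrict A∅ R∅

  Split-□⇒Split-first : ∀ {P Q} → Split (A □ R) (P ++ Q) → Split A P
  Split-□⇒Split-first {P} {Q} split U = Sum.map free-case span-case (split (U ++ ∅))
    where
    open ≤-Reasoning
    free-case : rank K ((U ++ ∅) ∩ (P ++ Q)) + ∣ (U ++ ∅) ─ (P ++ Q) ∣ ≤ rank K (U ++ ∅) →
                rank A (U ∩ P) + ∣ U ─ P ∣ ≤ rank A U
    free-case = subst₂ _≤_
      (cong₂ _+_ (trans (cong (rank K) (trans (∩-++ U P ∅ Q) (cong ((U ∩ P) ++_) (∩-zeroˡ Q)))) (rank-K (U ∩ P)))
                 (trans (cong ∣_∣ (trans (─-++ U P ∅ Q) (cong ((U ─ P) ++_) (∅─p≡∅ Q)))) (∣++∅∣ (U ─ P))))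
      (rank-K U)
    span-case : rank K ((U ++ ∅) ∪ (P ++ Q)) ≤ rank K (U ++ ∅) → rank A (U ∪ P) ≤ rank A U
    span-case K-spans = begin
      rank A (U ∪ P)                ≡⟨ rank-K (U ∪ P) ⟨
      rank K ((U ∪ P) ++ ∅)         ≤⟨ rank-mono K (□-∅ {A = A} {R} A∅ R∅) (++∅⊆++ (U ∪ P)) ⟩
      rank K ((U ∪ P) ++ Q)         ≡⟨ cong (rank K) (trans (∪-++ U P ∅ Q) (cong ((U ∪ P) ++_) (∪-identityˡ Q))) ⟨
      rank K ((U ++ ∅) ∪ (P ++ Q))  ≤⟨ K-spans ⟩
      rank K (U ++ ∅)               ≡⟨ rank-K U ⟩
      rank A U                      ∎

  Split-□⇒Split-any : ∀ {Q} → Split (A □ R) (∅ ++ Q) → Nonempty Q → ∀ T → Split A T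
  Split-□⇒Split-any {Q} split (j , j∈Q) T U = Sum.map free-case span-case (split (U ++ ∅))
    where
    open ≤-Reasoning
    free-case : rank K ((U ++ ∅) ∩ (∅ ++ Q)) + ∣ (U ++ ∅) ─ (∅ ++ Q) ∣ ≤ rank K (U ++ ∅) →
                rank A (U ∩ T) + ∣ U ─ T ∣ ≤ rank A U
    free-case U-free = begin
      rank A (U ∩ T) + ∣ U ─ T ∣       ≤⟨ +-monoˡ-≤ ∣ U ─ T ∣ (rank≤∣∣ A A∅ (U ∩ T)) ⟩
      ∣ U ∩ T ∣ + ∣ U ─ T ∣            ≡⟨ ∣p∩q∣+∣p─q∣≡∣p∣ U T ⟩
      ∣ U ∣                            ≡⟨ trans (cong ∣_∣ U∅─∅Q) (∣++∅∣ U) ⟨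
      ∣ (U ++ ∅) ─ (∅ ++ Q) ∣          ≤⟨ m≤n+m _ (rank K ((U ++ ∅) ∩ (∅ ++ Q))) ⟩
      _                                ≤⟨ U-free ⟩
      rank K (U ++ ∅)                  ≡⟨ rank-K U ⟩
      rank A U                         ∎
      where
      U∅─∅Q : (U ++ ∅) ─ (∅ ++ Q) ≡ U ++ ∅
      U∅─∅Q = trans (─-++ U ∅ ∅ Q) (cong₂ _++_ (p─⊥≡p U) (∅─p≡∅ Q))
    U+Q≤ : rank K ((U ++ ∅) ∪ (∅ ++ Q)) ≤ rank K (U ++ ∅) → rank K (U ++ Q) ≤ rank A U
    U+Q≤ = subst₂ _≤_ (cong (rank K) (trans (∪-++ U ∅ ∅ Q) (cong₂ _++_ (∪-identityʳ U) (∪-identityˡ Q)))) (rank-K U)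
    span-case : rank K ((U ++ ∅) ∪ (∅ ++ Q)) ≤ rank K (U ++ ∅) → rank A (U ∪ T) ≤ rank A U
    span-case U-spans with rank-□ A∅ R∅ U Q
    ... | inj₁ U+Q-free = ⊥-elim (<-irrefl refl (begin-strict
      rank A U                         <⟨ m<m+n (rank A U) (subst (0 <_) (sym (∣p∣≡1+∣p-x∣ Q j∈Q)) z<s) ⟩
      rank A U + ∣ Q ∣                 ≤⟨ U+Q-free ⟩
      rank K (U ++ Q)                  ≤⟨ U+Q≤ U-spans ⟩
      rank A U                         ∎))
    ... | inj₂ full+Q≤ = begin
      rank A (U ∪ T)                   ≤⟨ rank-mono A A∅ ⊆⊤ ⟩
      rank A full                      ≡⟨ rank-K full ⟨
      rank K (full {a} ++ ∅)           ≤⟨ rank-mono K (□-∅ {A = A} {R} A∅ R∅) (++∅⊆++ (full {a})) ⟩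
      rank K (full ++ Q)               ≤⟨ full+Q≤ ⟩
      rank K (U ++ Q)                  ≤⟨ U+Q≤ U-spans ⟩
      rank A U                         ∎

module _ {I : IndSys (p + q)} (isM : IsMatroid I) (split : Split I (firstBlock p q))
         {B : Subset p} (isB : IsBasis I (firstBlock p q) (B ++ ∅)) where
  open IsMatroid isM

  private
    X : IndSys p
    X U = I (U ++ ∅)
    Y : IndSys q
    Y V = I (B ++ V)
    F : Subset q → ℕ
    F V = rank I (full ++ V)
    rL : ℕ
    rL = rank I (firstBlock p q)

    X∅ : X ∅ ≡ true
    X∅ = IsMatroid.∅-independent (IsMatroid-restrict {p} {q} isM)
    IB∅ : I (B ++ ∅) ≡ true
    IB∅ = proj₁ (proj₂ isB)

    rank-X : ∀ U → rank X U ≡ rank I (U ++ ∅)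
    rank-X U = sym (rank-restrict ∅-independent (λ _ → refl) U)

    ∣B∣≡rL : ∣ B ∣ ≡ rL
    ∣B∣≡rL = trans (sym (∣++∅∣ B)) (proj₂ (proj₂ isB))

    rank-B++ : ∀ V → rank I (B ++ V) ≡ F V
    rank-B++ V = ≤-antisym (rank-mono I ∅-independent (⊆-++⁺ {U = B} ⊆⊤ ⊆-refl))
      (subst₂ _≤_ (cong (rank I) (trans (∪-++ full ∅ ∅ V) (cong₂ _++_ (∪-identityʳ full) (∪-identityˡ V))))
                  (cong (rank I) (trans (∪-++ B ∅ ∅ V) (cong₂ _++_ (∪-identityʳ B) (∪-identityˡ V))))
                  (basis-spans isM isB (∅ ++ V)))

    rank-Y : ∀ V → rank Y V ≡ F V ∸ rL
    rank-Y V = trans (sym (m+n∸m≡n ∣ B ∣ (rank Y V)))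
                     (cong₂ _∸_ (trans (sym (rank-contract isM IB∅ V)) (rank-B++ V)) ∣B∣≡rL)

    ≤rank-X-full : ∀ {U} → X U ≡ true → ∣ U ∣ ≤ rL
    ≤rank-X-full {U} XU = subst (∣ U ∣ ≤_) (rank-X full) (∣indep∣≤rank X ⊆⊤ XU)

    rL≤F : ∀ V → rL ≤ F V
    rL≤F V = rank-mono I ∅-independent (++∅⊆++ (full {p}))

    indep⇔ : ∀ {U V} → X U ≡ true → (nullity Y V ≤ rankLack X U ⇔ ∣ U ∣ + ∣ V ∣ ≤ F V)
    indep⇔ {U} {V} XU = subst₂ (λ ν λ′ → (ν ≤ λ′) ⇔ (∣ U ∣ + ∣ V ∣ ≤ F V))
      (cong (∣ V ∣ ∸_) (sym (rank-Y V))) (cong₂ _∸_ (sym (rank-X full)) (sym (indep⇒rank≡∣∣ X X∅ XU)))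
      (∸∸≤∸⇔+≤ (≤rank-X-full XU) (rL≤F V))

  Split⇒≅restrict□contract : I ≅ᵢ ((λ U → I (U ++ ∅ {q})) □ (λ V → I (B ++ V)))
  Split⇒≅restrict□contract =
    ≗⇒≅ᵢ (∀-++ (λ W → I W ≡ (X □ Y) W) λ U V → ≡true-ext (indep⇒□-indep U V) (□-indep⇒indep U V))
    where
    indep⇒□-indep : ∀ U V → I (U ++ V) ≡ true → (X □ Y) (U ++ V) ≡ true
    indep⇒□-indep U V IUV = □-indep⁺ X Y XU (Equivalence.from (indep⇔ XU)
      (subst (_≤ F V) (∣++∣ U V) (∣indep∣≤rank I (⊆-++⁺ {U = U} ⊆⊤ ⊆-refl) IUV)))
      where
      XU : X U ≡ true
      XU = hereditary _ _ (++∅⊆++ U) IUV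
    □-indep⇒indep : ∀ U V → (X □ Y) (U ++ V) ≡ true → I (U ++ V) ≡ true
    □-indep⇒indep U V K[UV] with XU , ν≤λ ← □-indep⁻ X Y {U} {V} K[UV] =
      ∣∣≤rank⇒indep I ∅-independent (subst (_≤ rank I (U ++ V)) (sym (∣++∣ U V))
        ([ subst (λ r → r + ∣ V ∣ ≤ rank I (U ++ V)) (trans (sym (rank-X U)) (indep⇒rank≡∣∣ X X∅ XU))
         , ≤-trans ∣U∣+∣V∣≤F ]′ (Split-first-block⁻ split U V)))
      where
      ∣U∣+∣V∣≤F : ∣ U ∣ + ∣ V ∣ ≤ F V
      ∣U∣+∣V∣≤F = Equivalence.to (indep⇔ XU) ν≤λ

Split⇒≅□ : ∀ {I : IndSys (p + q)} → IsMatroid I → Split I (firstBlock p q) →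
            ∃₂ λ (X : IndSys p) (Y : IndSys q) → IsMatroid X × IsMatroid Y × I ≅ᵢ (X □ Y)
Split⇒≅□ {p} {q} {I} isM split with B , isB ← basis-++∅ I (IsMatroid.∅-independent isM) (full {p}) =
  _ , _ , IsMatroid-restrict {p} {q} isM , IsMatroid-contract {p} {q} isM {B} (proj₁ (proj₂ isB))
  , Split⇒≅restrict□contract {p} {q} isM split isB

-- An irreducible matroid has no proper split

-- Moves 0 to position p, the front of the second block.
shift : ∀ p q → Fin (suc (p + q)) ↔ Fin (p + suc q)
shift zero    q = Perm.id
shift (suc p) q = transpose zero (suc zero) ∘ₚ lift₀ (shift p q)

image-shift : ∀ p {q} b (U : Subset p) (V : Subset q) → image (shift p q) (b ∷ (U ++ V)) ≡ U ++ (b ∷ V)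
image-shift zero    b []      V = image-id (b ∷ V)
image-shift (suc p) b (c ∷ U) V = begin
  image (transpose zero (suc zero) ∘ₚ lift₀ (shift p _)) (b ∷ c ∷ (U ++ V))
    ≡⟨ image-∘ₚ (transpose zero (suc zero)) (lift₀ (shift p _)) (b ∷ c ∷ (U ++ V)) ⟨
  image (lift₀ (shift p _)) (image (transpose zero (suc zero)) (b ∷ c ∷ (U ++ V)))
    ≡⟨ cong (λ W → c ∷ image (shift p _) (b ∷ W)) (tabulate∘lookup (U ++ V)) ⟩
  c ∷ image (shift p _) (b ∷ (U ++ V))
    ≡⟨ cong (c ∷_) (image-shift p b U V) ⟩
  c ∷ (U ++ (b ∷ V))
    ∎
  where open ≡-Reasoning

sort : ∀ (P : Subset n) → ∃₂ λ p q → Σ (Fin n ↔ Fin (p + q)) λ π → image π P ≡ firstBlock p q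
sort []            = 0 , 0 , Perm.id , refl
sort (inside  ∷ P) with p , q , π , πP≡ ← sort P = suc p , q , lift₀ π , cong (inside ∷_) πP≡
sort (outside ∷ P) with p , q , π , πP≡ ← sort P = p , suc q , lift₀ π ∘ₚ shift p q , (begin
  image (lift₀ π ∘ₚ shift p q) (outside ∷ P)         ≡⟨ image-∘ₚ (lift₀ π) (shift p q) (outside ∷ P) ⟨
  image (shift p q) (outside ∷ image π P)            ≡⟨ cong (λ W → image (shift p q) (outside ∷ W)) πP≡ ⟩
  image (shift p q) (outside ∷ firstBlock p q)       ≡⟨ image-shift p outside full ∅ ⟩
  firstBlock p (suc q)                               ∎)
  where open ≡-Reasoning

module _ (p q : ℕ) where

  pad : Fin (p + q) ↔ Fin (p + (q + 0))
  pad = Perm.cast-id (cong (p +_) (sym (+-identityʳ q)))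

  image-pad : ∀ (U : Subset p) (V : Subset q) → image pad (U ++ V) ≡ U ++ (V ++ [])
  image-pad U V = begin
    image pad (U ++ V)
      ≡⟨ Pointwise-≡⇒≡ (ext λ y → trans (lookup-image pad (U ++ V) y) (sym (lookup-cast₁ _ (U ++ V) y))) ⟩
    Vec.cast (cong (p +_) (sym (+-identityʳ q))) (U ++ V)
      ≡⟨ cast-++ʳ (sym (+-identityʳ q)) U ⟩
    U ++ Vec.cast (sym (+-identityʳ q)) V
      ≡⟨ cong (U ++_) (cast-sym (+-identityʳ q) (++-identityʳ-eqFree V)) ⟩
    U ++ (V ++ [])
      ∎
    where open ≡-Reasoning

□-≅ᵢ-□-emptyInd : ∀ {X : IndSys p} {Y : IndSys q} → Y ∅ ≡ true → (X □ Y) ≅ᵢ (X □ (Y □ emptyInd))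
□-≅ᵢ-□-emptyInd {p} {q} {X} {Y} Y∅ = pad p q , ∀-++ _ λ U V → begin
  (X □ Y) (U ++ V)                                          ≡⟨ □-++ X Y U V ⟩
  X U ∧ (rankLack X U ≥ᵇ nullity Y V)                       ≡⟨ cong (λ ν → X U ∧ (rankLack X U ≥ᵇ ν)) nullity-pad ⟨
  X U ∧ (rankLack X U ≥ᵇ nullity (Y □ emptyInd) (V ++ []))  ≡⟨ □-++ X (Y □ emptyInd) U (V ++ []) ⟨
  (X □ (Y □ emptyInd)) (U ++ (V ++ []))                     ≡⟨ cong (X □ (Y □ emptyInd)) (image-pad p q U V) ⟨
  (X □ (Y □ emptyInd)) (image (pad p q) (U ++ V))           ∎
  where
  open ≡-Reasoning
  nullity-pad : ∀ {V} → nullity (Y □ emptyInd) (V ++ []) ≡ nullity Y V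
  nullity-pad {V} = cong₂ _∸_ (∣++∅∣ V) (rank-□-restrict Y∅ refl V)

relabel : ∀ {n m} → Fin n ↔ Fin m → IndSys n → IndSys m
relabel π I W = I (image (flip π) W)

relabel-≅ᵢ : ∀ {n m} (π : Fin n ↔ Fin m) (I : IndSys n) → relabel π I ≅ᵢ I
relabel-≅ᵢ π I = flip π , λ W → refl

Irreducible⇒Split-trivial : ∀ (M : Matroid) → Irreducible M → ∀ {P} → Split (indep M) P →
                            ∀ {x y} → x ∈ P → y ∉ P → ⊥
Irreducible⇒Split-trivial M (_ , irreducible) {P} split {x} {y} x∈P y∉P = sorted (sort P)
  where
  sorted : (∃₂ λ p q → Σ (Fin (size M) ↔ Fin (p + q)) λ π → image π P ≡ firstBlock p q) → ⊥
  sorted (p , q , π , πP≡) = factored (Split⇒≅□ {p} {q} isK split-K)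
    where
    isK : IsMatroid (relabel π (indep M))
    isK = IsMatroid-≅ᵢ (relabel-≅ᵢ π (indep M)) (isMatroid M)
    split-K : Split (relabel π (indep M)) (firstBlock p q)
    split-K = subst (Split (relabel π (indep M))) πP≡ (Split-≅ᵢ (indep-∅ M) (relabel-≅ᵢ π (indep M)) split)
    ∣P∣≡p : ∣ P ∣ ≡ p
    ∣P∣≡p = trans (sym (∣image∣ π P)) (trans (cong ∣_∣ πP≡) (trans (∣++∅∣ {q = q} (full {p})) (∣⊤∣≡n p)))
    factored : (∃₂ λ (X : IndSys p) (Y : IndSys q) → IsMatroid X × IsMatroid Y × relabel π (indep M) ≅ᵢ (X □ Y)) → ⊥
    factored (X , Y , isX , isY , K≅X□Y) = no-factor-is-M (irreducible (matroid isX ∷ matroid isY ∷ []) M≅X□Y)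
      where
      M≅X□Y : indep M ≅ᵢ ⨂ (matroid isX ∷ matroid isY ∷ [])
      M≅X□Y = ≅ᵢ-trans {L = X □ (Y □ emptyInd)} (≅ᵢ-sym {I = relabel π (indep M)} (relabel-≅ᵢ π (indep M)))
                (≅ᵢ-trans {J = X □ Y} {L = X □ (Y □ emptyInd)} K≅X□Y
                          (□-≅ᵢ-□-emptyInd {X = X} (IsMatroid.∅-independent isY)))
      no-factor-is-M : Any (λ N → N ≅ M) (matroid isX ∷ matroid isY ∷ []) → ⊥
      no-factor-is-M (Any.here (τ , _))         = <-irrefl (trans ∣P∣≡p (↔⇒≡ τ)) (∉⇒∣p∣<n y∉P)
      no-factor-is-M (Any.there (Any.here (τ , _))) = <-irrefl (sym p≡0) (subst (0 <_) ∣P∣≡p (∈⇒0<∣p∣ x∈P))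
        where
        p≡0 : p ≡ 0
        p≡0 = +-cancelʳ-≡ q p 0 (trans (sym (↔⇒≡ π)) (sym (↔⇒≡ τ)))

-- Clones

transpose-i : ∀ (i j : Fin n) → PC.transpose i j i ≡ j
transpose-i i j with i ≟ i
... | yes _   = refl
... | no  i≢i = ⊥-elim (i≢i refl)

transpose-j : ∀ (i j : Fin n) → PC.transpose i j j ≡ i
transpose-j i j with j ≟ i
... | yes j≡i = j≡i
... | no  _ with j ≟ j
...   | yes _   = refl
...   | no  j≢j = ⊥-elim (j≢j refl)

transpose-other : ∀ {i j k : Fin n} → k ≢ i → k ≢ j → PC.transpose i j k ≡ k
transpose-other {i = i} {j} {k} k≢i k≢j with k ≟ i
... | yes k≡i = ⊥-elim (k≢i k≡i)
... | no  _ with k ≟ j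
...   | yes k≡j = ⊥-elim (k≢j k≡j)
...   | no  _   = refl

image-transpose : ∀ {u v : Fin n} (W W′ : Subset n) → lookup W′ u ≡ lookup W v → lookup W′ v ≡ lookup W u →
                  (∀ j → j ≢ u → j ≢ v → lookup W′ j ≡ lookup W j) → image (transpose u v) W ≡ W′
image-transpose {u = u} {v} W W′ at-u at-v elsewhere =
  Pointwise-≡⇒≡ (ext λ j → trans (lookup-image (transpose u v) W j) (pointwise j))
  where
  pointwise : ∀ j → lookup W (PC.transpose v u j) ≡ lookup W′ j
  pointwise j with u ≟ j | v ≟ j
  ... | yes refl | _        = trans (cong (lookup W) (transpose-j v u)) (sym at-u)
  ... | no  _    | yes refl = trans (cong (lookup W) (transpose-i v u)) (sym at-v)
  ... | no  u≢j  | no  v≢j  =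
    trans (cong (lookup W) (transpose-other (v≢j ∘ sym) (u≢j ∘ sym))) (sym (elsewhere j (u≢j ∘ sym) (v≢j ∘ sym)))

image-transpose-∪⁅⁆ : ∀ {u v : Fin n} {X} → u ≢ v → u ∉ X → v ∉ X →
                      image (transpose u v) (X ∪ ⁅ u ⁆) ≡ X ∪ ⁅ v ⁆ × image (transpose u v) (X ∪ ⁅ v ⁆) ≡ X ∪ ⁅ u ⁆
image-transpose-∪⁅⁆ {u = u} {v} {X} u≢v u∉X v∉X =
  image-transpose (X ∪ ⁅ u ⁆) (X ∪ ⁅ v ⁆)
    (trans X+v-at-u (sym X+u-at-v)) (trans (lookup-∪⁅x⁆-x X v) (sym (lookup-∪⁅x⁆-x X u)))
    (λ j j≢u j≢v → trans (lookup-∪⁅x⁆-≢ X j≢v) (sym (lookup-∪⁅x⁆-≢ X j≢u))) ,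
  image-transpose (X ∪ ⁅ v ⁆) (X ∪ ⁅ u ⁆)
    (trans (lookup-∪⁅x⁆-x X u) (sym (lookup-∪⁅x⁆-x X v))) (trans X+u-at-v (sym X+v-at-u))
    (λ j j≢u j≢v → trans (lookup-∪⁅x⁆-≢ X j≢u) (sym (lookup-∪⁅x⁆-≢ X j≢v)))
  where
  X+v-at-u : lookup (X ∪ ⁅ v ⁆) u ≡ false
  X+v-at-u = trans (lookup-∪⁅x⁆-≢ X u≢v) (∉⇒lookup≡false X u∉X)
  X+u-at-v : lookup (X ∪ ⁅ u ⁆) v ≡ false
  X+u-at-v = trans (lookup-∪⁅x⁆-≢ X (u≢v ∘ sym)) (∉⇒lookup≡false X v∉X)

module _ {I : IndSys n} (I∅ : I ∅ ≡ true) where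

  clone-≤ : ∀ {u v X} → Split I ⁅ u ⁆ → u ≢ v → u ∉ X → v ∉ X → rank I (X ∪ ⁅ u ⁆) ≤ rank I (X ∪ ⁅ v ⁆)
  clone-≤ {u} {v} {X} split-u u≢v u∉X v∉X with split-u (X ∪ ⁅ v ⁆)
  ... | inj₁ X+v-free = begin
    rank I (X ∪ ⁅ u ⁆)                                        ≤⟨ rank≤∣∣ I I∅ (X ∪ ⁅ u ⁆) ⟩
    ∣ X ∪ ⁅ u ⁆ ∣                                             ≡⟨ ∣p∪⁅x⁆∣≡1+∣p∣ X u∉X ⟩
    suc ∣ X ∣                                                 ≡⟨ ∣p∪⁅x⁆∣≡1+∣p∣ X v∉X ⟨
    ∣ X ∪ ⁅ v ⁆ ∣                                             ≡⟨ cong ∣_∣ (x∉p⇒p-x≡p (X ∪ ⁅ v ⁆) u∉X+v) ⟨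
    ∣ (X ∪ ⁅ v ⁆) ─ ⁅ u ⁆ ∣                                   ≤⟨ m≤n+m _ _ ⟩
    rank I ((X ∪ ⁅ v ⁆) ∩ ⁅ u ⁆) + ∣ (X ∪ ⁅ v ⁆) ─ ⁅ u ⁆ ∣   ≤⟨ X+v-free ⟩
    rank I (X ∪ ⁅ v ⁆)                                        ∎
    where
    open ≤-Reasoning
    u∉X+v : u ∉ X ∪ ⁅ v ⁆
    u∉X+v u∈ with x∈p∪q⁻ X ⁅ v ⁆ u∈
    ... | inj₁ u∈X = u∉X u∈X
    ... | inj₂ u∈v = u≢v (x∈⁅y⁆⇒x≡y v u∈v)
  ... | inj₂ X+v-spans-u = ≤-trans (rank-mono I I∅ (∪-monoˡ-⊆ (p⊆p∪q ⁅ v ⁆))) X+v-spans-u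

  module _ {u v} (split-u : Split I ⁅ u ⁆) (split-v : Split I ⁅ v ⁆) (u≢v : u ≢ v) where

    clone-≡ : ∀ {X} → u ∉ X → v ∉ X → rank I (X ∪ ⁅ u ⁆) ≡ rank I (X ∪ ⁅ v ⁆)
    clone-≡ u∉X v∉X = ≤-antisym (clone-≤ split-u u≢v u∉X v∉X) (clone-≤ split-v (u≢v ∘ sym) v∉X u∉X)

    rank-image-transpose : ∀ W → rank I (image (transpose u v) W) ≡ rank I W
    rank-image-transpose W with u ∈? W | v ∈? W
    ... | yes u∈W | yes v∈W = cong (rank I) (image-transpose W W
            (trans ([]=⇒lookup u∈W) (sym ([]=⇒lookup v∈W)))
            (trans ([]=⇒lookup v∈W) (sym ([]=⇒lookup u∈W))) (λ _ _ _ → refl))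
    ... | no  u∉W | no  v∉W = cong (rank I) (image-transpose W W
            (trans (∉⇒lookup≡false W u∉W) (sym (∉⇒lookup≡false W v∉W)))
            (trans (∉⇒lookup≡false W v∉W) (sym (∉⇒lookup≡false W u∉W))) (λ _ _ _ → refl))
    ... | yes u∈W | no  v∉W = begin
      rank I (image (transpose u v) W)             ≡⟨ cong (λ W → rank I (image (transpose u v) W)) W≡ ⟩
      rank I (image (transpose u v) ((W - u) ∪ ⁅ u ⁆)) ≡⟨ cong (rank I) (proj₁ (image-transpose-∪⁅⁆ u≢v (x∉p-x W) v∉W-u)) ⟩
      rank I ((W - u) ∪ ⁅ v ⁆)                     ≡⟨ clone-≡ (x∉p-x W) v∉W-u ⟨
      rank I ((W - u) ∪ ⁅ u ⁆)                     ≡⟨ cong (rank I) W≡ ⟨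
      rank I W                                     ∎
      where
      open ≡-Reasoning
      W≡ : W ≡ (W - u) ∪ ⁅ u ⁆
      W≡ = sym (p-x∪⁅x⁆≡p W u∈W)
      v∉W-u : v ∉ W - u
      v∉W-u = v∉W ∘ p─q⊆p W ⁅ u ⁆
    ... | no  u∉W | yes v∈W = begin
      rank I (image (transpose u v) W)             ≡⟨ cong (λ W → rank I (image (transpose u v) W)) W≡ ⟩
      rank I (image (transpose u v) ((W - v) ∪ ⁅ v ⁆)) ≡⟨ cong (rank I) (proj₂ (image-transpose-∪⁅⁆ u≢v u∉W-v (x∉p-x W))) ⟩
      rank I ((W - v) ∪ ⁅ u ⁆)                     ≡⟨ clone-≡ u∉W-v (x∉p-x W) ⟩
      rank I ((W - v) ∪ ⁅ v ⁆)                     ≡⟨ cong (rank I) W≡ ⟨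
      rank I W                                     ∎
      where
      open ≡-Reasoning
      W≡ : W ≡ (W - v) ∪ ⁅ v ⁆
      W≡ = sym (p-x∪⁅x⁆≡p W v∈W)
      u∉W-v : u ∉ W - v
      u∉W-v = u∉W ∘ p─q⊆p W ⁅ v ⁆

    clones⇒automorphism : ∀ W → I W ≡ I (image (transpose u v) W)
    clones⇒automorphism W = ∣∣≡∧rank≡⇒indep≡ I I∅ (sym (∣image∣ (transpose u v) W)) (sym (rank-image-transpose W))

    ≅ᵢ-transpose-clones : ∀ {k} {N : IndSys k} → ((σ , _) : I ≅ᵢ N) →
                          Σ (I ≅ᵢ N) λ (θ , _) → image θ ⁅ u ⁆ ≡ ⁅ σ ⟨$⟩ʳ v ⁆
    ≅ᵢ-transpose-clones {N = N} (σ , I≡N) = (transpose u v ∘ₚ σ , I≡N∘θ) , θ[u]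
      where
      I≡N∘θ : ∀ W → I W ≡ N (image (transpose u v ∘ₚ σ) W)
      I≡N∘θ W = trans (clones⇒automorphism W)
                      (trans (I≡N (image (transpose u v) W)) (cong N (image-∘ₚ (transpose u v) σ W)))
      θ[u] : image (transpose u v ∘ₚ σ) ⁅ u ⁆ ≡ ⁅ σ ⟨$⟩ʳ v ⁆
      θ[u] = begin
        image (transpose u v ∘ₚ σ) ⁅ u ⁆       ≡⟨ image-∘ₚ (transpose u v) σ ⁅ u ⁆ ⟨
        image σ (image (transpose u v) ⁅ u ⁆)  ≡⟨ cong (image σ) (image-⁅⁆ (transpose u v) u) ⟩
        image σ ⁅ PC.transpose u v u ⁆         ≡⟨ cong (image σ ∘ ⁅_⁆) (transpose-i u v) ⟩
        image σ ⁅ v ⁆                          ≡⟨ image-⁅⁆ σ v ⟩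
        ⁅ σ ⟨$⟩ʳ v ⁆                           ∎
        where open ≡-Reasoning

-- Cancellation of irreducible first factors

module _ (φ : Fin (p + q) → Fin (p′ + q′))
         (φ-first : ∀ x → lookup (firstBlock p′ q′) (φ x) ≡ lookup (firstBlock p q) x) where

  restrict-first : Σ (Fin p → Fin p′) λ f → ∀ i → φ (i ↑ˡ q) ≡ f i ↑ˡ q′
  restrict-first = (λ i → proj₁ (in-first i)) , (λ i → sym (proj₂ (in-first i)))
    where
    in-first : ∀ i → ∃ λ i′ → i′ ↑ˡ q′ ≡ φ (i ↑ˡ q)
    in-first i = firstBlock-true⇒↑ˡ (φ (i ↑ˡ q)) (trans (φ-first (i ↑ˡ q)) (lookup-firstBlock-↑ˡ i))

  restrict-second : Σ (Fin q → Fin q′) λ g → ∀ j → φ (p ↑ʳ j) ≡ p′ ↑ʳ g j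
  restrict-second = (λ j → proj₁ (in-second j)) , (λ j → sym (proj₂ (in-second j)))
    where
    in-second : ∀ j → ∃ λ j′ → p′ ↑ʳ j′ ≡ φ (p ↑ʳ j)
    in-second j = firstBlock-false⇒↑ʳ (φ (p ↑ʳ j)) (trans (φ-first (p ↑ʳ j)) (lookup-firstBlock-↑ʳ {p = p} j))

module _ {a m c m′} (θ : Fin (a + m) ↔ Fin (c + m′)) (θ-first : image θ (firstBlock a m) ≡ firstBlock c m′) where

  private
    θ-pres : ∀ x → lookup (firstBlock c m′) (θ ⟨$⟩ʳ x) ≡ lookup (firstBlock a m) x
    θ-pres x = begin
      lookup (firstBlock c m′) (θ ⟨$⟩ʳ x)               ≡⟨ cong (λ S → lookup S (θ ⟨$⟩ʳ x)) θ-first ⟨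
      lookup (image θ (firstBlock a m)) (θ ⟨$⟩ʳ x)       ≡⟨ lookup-image θ (firstBlock a m) (θ ⟨$⟩ʳ x) ⟩
      lookup (firstBlock a m) (θ ⟨$⟩ˡ (θ ⟨$⟩ʳ x))       ≡⟨ cong (lookup (firstBlock a m)) (inverseˡ θ) ⟩
      lookup (firstBlock a m) x                         ∎
      where open ≡-Reasoning

    θ⁻¹-pres : ∀ y → lookup (firstBlock a m) (θ ⟨$⟩ˡ y) ≡ lookup (firstBlock c m′) y
    θ⁻¹-pres y = trans (sym (lookup-image θ (firstBlock a m) y)) (cong (λ S → lookup S y) θ-first)

    bijection : ∀ {k k′} (e : Fin k → Fin (a + m)) (e′ : Fin k′ → Fin (c + m′)) →
                Injective _≡_ _≡_ e → Injective _≡_ _≡_ e′ →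
                (Σ (Fin k → Fin k′) λ f → ∀ i → θ ⟨$⟩ʳ e i ≡ e′ (f i)) →
                (Σ (Fin k′ → Fin k) λ f⁻ → ∀ i → θ ⟨$⟩ˡ e′ i ≡ e (f⁻ i)) → Fin k ↔ Fin k′
    bijection e e′ e-inj e′-inj (f , θ∘e) (f⁻ , θ⁻¹∘e′) = permutation f f⁻
      (λ i → e′-inj (trans (sym (θ∘e (f⁻ i))) (trans (cong (θ ⟨$⟩ʳ_) (sym (θ⁻¹∘e′ i))) (inverseʳ θ))))
      (λ i → e-inj (trans (sym (θ⁻¹∘e′ (f i))) (trans (cong (θ ⟨$⟩ˡ_) (sym (θ∘e i))) (inverseˡ θ))))

    θ⁻¹-first : Σ (Fin c → Fin a) λ f⁻ → ∀ i → θ ⟨$⟩ˡ (i ↑ˡ m′) ≡ f⁻ i ↑ˡ m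
    θ⁻¹-first = restrict-first (θ ⟨$⟩ˡ_) θ⁻¹-pres

    θ⁻¹-second : Σ (Fin m′ → Fin m) λ g⁻ → ∀ j → θ ⟨$⟩ˡ (c ↑ʳ j) ≡ a ↑ʳ g⁻ j
    θ⁻¹-second = restrict-second (θ ⟨$⟩ˡ_) θ⁻¹-pres

  first-bijection : Fin a ↔ Fin c
  first-bijection = bijection (_↑ˡ m) (_↑ˡ m′) (↑ˡ-injective m _ _) (↑ˡ-injective m′ _ _)
        (restrict-first (θ ⟨$⟩ʳ_) θ-pres) θ⁻¹-first

  second-bijection : Fin m ↔ Fin m′
  second-bijection = bijection (a ↑ʳ_) (c ↑ʳ_) (↑ʳ-injective a _ _) (↑ʳ-injective c _ _)
        (restrict-second (θ ⟨$⟩ʳ_) θ-pres) θ⁻¹-second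

  image-++ : ∀ U V → image θ (U ++ V) ≡ image first-bijection U ++ image second-bijection V
  image-++ U V = ++-ext {U = image first-bijection U} {image second-bijection V}
    (λ i → trans (lookup-image θ (U ++ V) (i ↑ˡ m′)) (trans (cong (lookup (U ++ V)) (proj₂ θ⁻¹-first i))
             (trans (lookup-++ˡ U V _) (sym (lookup-image first-bijection U i)))))
    (λ j → trans (lookup-image θ (U ++ V) (c ↑ʳ j)) (trans (cong (lookup (U ++ V)) (proj₂ θ⁻¹-second j))
             (trans (lookup-++ʳ U V _) (sym (lookup-image second-bijection V j)))))

module _ {a m c m′} {A : IndSys a} {R : IndSys m} {C : IndSys c} {R′ : IndSys m′}
         (A∅ : A ∅ ≡ true) (R∅ : R ∅ ≡ true) (C∅ : C ∅ ≡ true) (R′∅ : R′ ∅ ≡ true) where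

  □-≅ᵢ-blockwise : ((θ , _) : (A □ R) ≅ᵢ (C □ R′)) → image θ (firstBlock a m) ≡ firstBlock c m′ →
                   A ≅ᵢ C × R ≅ᵢ R′
  □-≅ᵢ-blockwise (θ , K≡N) θ-first = A≅C , R≅R′
    where
    open ≡-Reasoning
    Fθ : Fin a ↔ Fin c
    Fθ = first-bijection θ θ-first
    Gθ : Fin m ↔ Fin m′
    Gθ = second-bijection θ θ-first
    A≅C : A ≅ᵢ C
    A≅C = Fθ , λ U → begin
      A U                                    ≡⟨ □-restrict A R U ⟨
      (A □ R) (U ++ ∅)                       ≡⟨ K≡N (U ++ ∅) ⟩
      (C □ R′) (image θ (U ++ ∅))            ≡⟨ cong (C □ R′) (image-++ {a} {m} {c} {m′} θ θ-first U ∅) ⟩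
      (C □ R′) (image Fθ U ++ image Gθ ∅)    ≡⟨ cong (λ V → (C □ R′) (image Fθ U ++ V)) (image-replicate Gθ false) ⟩
      (C □ R′) (image Fθ U ++ ∅)             ≡⟨ □-restrict C R′ (image Fθ U) ⟩
      C (image Fθ U)                         ∎
    R≅R′ : R ≅ᵢ R′
    R≅R′ with B , isB@(_ , AB , ∣B∣) ← basis A A∅ full = Gθ , λ V → begin
      R V                                    ≡⟨ □-contract {A = A} {R} A∅ R∅ isB V ⟨
      (A □ R) (B ++ V)                       ≡⟨ K≡N (B ++ V) ⟩
      (C □ R′) (image θ (B ++ V))            ≡⟨ cong (C □ R′) (image-++ {a} {m} {c} {m′} θ θ-first B V) ⟩
      (C □ R′) (image Fθ B ++ image Gθ V)    ≡⟨ □-contract {A = C} {R′} C∅ R′∅ isFB (image Gθ V) ⟩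
      R′ (image Gθ V)                        ∎
      where
      isFB : IsBasis C full (image Fθ B)
      isFB = ⊆⊤ , trans (sym (proj₂ A≅C B)) AB
           , trans (∣image∣ Fθ B) (trans ∣B∣ (trans (rank-≅ᵢ {I = A} {C} A∅ A≅C full)
                                               (cong (rank C) (image-replicate Fθ true))))

inhabitant : ∀ {n} → n ≢ 0 → Fin n
inhabitant {zero}  n≢0 = ⊥-elim (n≢0 refl)
inhabitant {suc n} _   = zero

module _ (A : Matroid) (irreducible : Irreducible A) {R : IndSys m} (R∅ : R ∅ ≡ true) where

  private
    a : ℕ
    a = size A
    K : IndSys (a + m)
    K = indep A □ R
    blocks : ∀ (S : Subset (a + m)) → S ≡ take a S ++ drop a S
    blocks S = sym (take++drop≡id a S)

  Split-□-first-all-or-none : ∀ {S} → Split K S → (∀ i → i ↑ˡ m ∈ S) ⊎ (∀ i → i ↑ˡ m ∉ S)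
  Split-□-first-all-or-none {S} split with any? (_∈? take a S)
  ... | yes (x , x∈P) = inj₁ λ i → ∈-take⁻ (in-P i)
    where
    split-P : Split (indep A) (take a S)
    split-P = Split-□⇒Split-first {A = indep A} {R} (indep-∅ A) R∅ (subst (Split K) (blocks S) split)
    in-P : ∀ i → i ∈ take a S
    in-P i with i ∈? take a S
    ... | yes i∈P = i∈P
    ... | no  i∉P = ⊥-elim (Irreducible⇒Split-trivial A irreducible split-P x∈P i∉P)
  ... | no  P-empty = inj₂ λ i i∈S → P-empty (i , ∈-take⁺ i∈S)

  Split-□-second⇒subsingleton : ∀ {S} → Split K S → (∀ i → i ↑ˡ m ∉ S) → ∀ {j} → a ↑ʳ j ∈ S →
                                ∀ (x y : Fin a) → y ≡ x
  Split-□-second⇒subsingleton {S} split none {j} j∈S x y with y ≟ x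
  ... | yes y≡x = y≡x
  ... | no  y≢x = ⊥-elim (Irreducible⇒Split-trivial A irreducible
                            (Split-□⇒Split-any {A = indep A} {R} (indep-∅ A) R∅ split′ (j , ∈-drop⁺ j∈S) ⁅ x ⁆)
                            (x∈⁅x⁆ x) (y≢x ∘ x∈⁅y⁆⇒x≡y x))
    where
    take≡∅ : take a S ≡ ∅
    take≡∅ = Empty-unique λ (i , i∈) → none i (∈-take⁻ i∈)
    split′ : Split K (∅ ++ drop a S)
    split′ = subst (Split K) (trans (blocks S) (cong (_++ drop a S) take≡∅)) split

module _ (A C : Matroid) (irrA : Irreducible A) (irrC : Irreducible C)
         {m m′} {R : IndSys m} {R′ : IndSys m′} (R∅ : R ∅ ≡ true) (R′∅ : R′ ∅ ≡ true)
         (σ : (indep A □ R) ≅ᵢ (indep C □ R′)) where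

  private
    a c : ℕ
    a = size A
    c = size C
    K : IndSys (a + m)
    K = indep A □ R
    N : IndSys (c + m′)
    N = indep C □ R′
    s : Fin (a + m) ↔ Fin (c + m′)
    s = proj₁ σ
    L : Subset (a + m)
    L = firstBlock a m
    L′ : Subset (c + m′)
    L′ = firstBlock c m′
    K∅ : K ∅ ≡ true
    K∅ = □-∅ {A = indep A} {R} (indep-∅ A) R∅
    N∅ : N ∅ ≡ true
    N∅ = □-∅ {A = indep C} {R′} (indep-∅ C) R′∅
    split-K : Split K (image (flip s) L′)
    split-K = Split-≅ᵢ {I = K} {N} N∅ σ (Split-□ {A = indep C} {R′} (indep-∅ C) R′∅)
    split-N : Split N (image s L)
    split-N = Split-≅ᵢ {I = N} {K} K∅ (≅ᵢ-sym {I = K} {N} σ) (Split-□ {A = indep A} {R} (indep-∅ A) R∅)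
    i₀ : Fin a
    i₀ = inhabitant (proj₁ irrA)
    i′₀ : Fin c
    i′₀ = inhabitant (proj₁ irrC)

    A-into-C A-avoids-C C-into-A C-avoids-A : Set
    A-into-C   = ∀ i → i ↑ˡ m ∈ image (flip s) L′
    A-avoids-C = ∀ i → i ↑ˡ m ∉ image (flip s) L′
    C-into-A   = ∀ i′ → i′ ↑ˡ m′ ∈ image s L
    C-avoids-A = ∀ i′ → i′ ↑ˡ m′ ∉ image s L

  BlockPreserving : Set
  BlockPreserving = Σ (K ≅ᵢ N) λ (θ , _) → image θ L ≡ L′

  private
    into-into : A-into-C → C-into-A → image s L ≡ L′
    into-into A→C C→A = ⊆-antisym image⊆L′ L′⊆image
      where
      image⊆L′ : image s L ⊆ L′
      image⊆L′ {y} y∈ = let i , i↑≡ = ∈firstBlock⇒↑ˡ {a} {m} (∈-image⁻ s y∈) in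
        subst (_∈ L′) (trans (cong (s ⟨$⟩ʳ_) i↑≡) (inverseʳ s)) (∈-image⁻ (flip s) (A→C i))
      L′⊆image : L′ ⊆ image s L
      L′⊆image {y} y∈ = let i′ , i′↑≡ = ∈firstBlock⇒↑ˡ {c} {m′} y∈ in subst (_∈ image s L) i′↑≡ (C→A i′)

    into-avoids : A-into-C → C-avoids-A → ⊥
    into-avoids A→C C↛A = let i′ , i′↑≡ = ∈firstBlock⇒↑ˡ {c} {m′} (∈-image⁻ (flip s) (A→C i₀)) in
      C↛A i′ (subst (_∈ image s L) (sym i′↑≡) (∈-image⁺ s (↑ˡ∈firstBlock i₀)))

    avoids-into : A-avoids-C → C-into-A → ⊥
    avoids-into A↛C C→A = let i , i↑≡ = ∈firstBlock⇒↑ˡ {a} {m} (∈-image⁻ s (C→A i′₀)) in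
      A↛C i (subst (_∈ image (flip s) L′) (sym i↑≡) (∈-image⁺ (flip s) (↑ˡ∈firstBlock i′₀)))

    -- Then A and C have one element each, u and u′, and v = σ⁻¹ u′ lies in the second block;
    -- {u} and {v} both split K, so swapping u and v repairs σ.
    avoids-avoids : A-avoids-C → C-avoids-A → BlockPreserving
    avoids-avoids A↛C C↛A =
      let θ-iso , θ[u] = ≅ᵢ-transpose-clones K∅ split-u split-v u≢v {N = N} σ in
      θ-iso , trans (cong (image (proj₁ θ-iso)) L≡⁅u⁆) (trans θ[u] (trans (cong ⁅_⁆ (inverseʳ s)) (sym L′≡⁅u′⁆)))
      where
      u : Fin (a + m)
      u = i₀ ↑ˡ m
      u′ : Fin (c + m′)
      u′ = i′₀ ↑ˡ m′
      v : Fin (a + m)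
      v = s ⟨$⟩ˡ u′
      v∈ : v ∈ image (flip s) L′
      v∈ = ∈-image⁺ (flip s) (↑ˡ∈firstBlock i′₀)
      L≡⁅u⁆ : L ≡ ⁅ u ⁆
      L≡⁅u⁆ = firstBlock≡⁅↑ˡ⁆ i₀ (Split-□-second⇒subsingleton A irrA R∅ split-K A↛C
                                     (proj₂ (∈-++-second {a} {m} A↛C v∈)))
      L′≡⁅u′⁆ : L′ ≡ ⁅ u′ ⁆
      L′≡⁅u′⁆ = firstBlock≡⁅↑ˡ⁆ i′₀ (Split-□-second⇒subsingleton C irrC R′∅ split-N C↛A
                                       (proj₂ (∈-++-second {c} {m′} C↛A (∈-image⁺ s (↑ˡ∈firstBlock i₀)))))
      split-u : Split K ⁅ u ⁆
      split-u = subst (Split K) L≡⁅u⁆ (Split-□ {A = indep A} {R} (indep-∅ A) R∅)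
      split-v : Split K ⁅ v ⁆
      split-v = subst (Split K) (trans (cong (image (flip s)) L′≡⁅u′⁆) (image-⁅⁆ (flip s) u′)) split-K
      u≢v : u ≢ v
      u≢v u≡v = A↛C i₀ (subst (_∈ image (flip s) L′) (sym u≡v) v∈)

  block-preserving : BlockPreserving
  block-preserving =
    [ (λ A→C → [ (λ C→A → σ , into-into A→C C→A) , (λ C↛A → ⊥-elim (into-avoids A→C C↛A)) ]′ C-dichotomy)
    , (λ A↛C → [ (λ C→A → ⊥-elim (avoids-into A↛C C→A)) , (λ C↛A → avoids-avoids A↛C C↛A) ]′ C-dichotomy)
    ]′ (Split-□-first-all-or-none A irrA R∅ split-K)
    where
    C-dichotomy : C-into-A ⊎ C-avoids-A
    C-dichotomy = Split-□-first-all-or-none C irrC R′∅ split-N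

  □-cancel : A ≅ C × R ≅ᵢ R′
  □-cancel = □-≅ᵢ-blockwise (indep-∅ A) R∅ (indep-∅ C) R′∅ (proj₁ block-preserving) (proj₂ block-preserving)

⨂-∅ : ∀ Ms → ⨂ Ms ∅ ≡ true
⨂-∅ []       = refl
⨂-∅ (M ∷ Ms) = □-∅ {A = indep M} {⨂ Ms} (indep-∅ M) (⨂-∅ Ms)

⨂-cancel : ∀ {Ms Ns} → All Irreducible Ms → All Irreducible Ns → ⨂ Ms ≅ᵢ ⨂ Ns → Pointwise _≅_ Ms Ns
⨂-cancel {[]}     {[]}     _                _                _ = []
⨂-cancel {[]}     {N ∷ Ns} _               ((N≢∅ , _) ∷ _) (σ , _) =
  ⊥-elim (¬Fin0 (σ ⟨$⟩ˡ (inhabitant N≢∅ ↑ˡ sizes Ns)))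
⨂-cancel {M ∷ Ms} {[]}     ((M≢∅ , _) ∷ _) _               (σ , _) =
  ⊥-elim (¬Fin0 (σ ⟨$⟩ʳ (inhabitant M≢∅ ↑ˡ sizes Ms)))
⨂-cancel {M ∷ Ms} {N ∷ Ns} (irrM ∷ irrMs)  (irrN ∷ irrNs)  σ =
  let M≅N , Ms≅Ns = □-cancel M N irrM irrN (⨂-∅ Ms) (⨂-∅ Ns) σ in M≅N ∷ ⨂-cancel irrMs irrNs Ms≅Ns

theorem6p17 : (M : Matroid) (Ms Ns : List Matroid) →
    All Irreducible Ms → All Irreducible Ns →
    M ≅⨂ Ms → M ≅⨂ Ns →
    Pointwise _≅_ Ms Ns
theorem6p17 M Ms Ns irrMs irrNs M≅⨂Ms M≅⨂Ns =
  ⨂-cancel irrMs irrNs (≅ᵢ-trans {J = indep M} {⨂ Ns} (≅ᵢ-sym {I = indep M} M≅⨂Ms) M≅⨂Ns)
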